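{- For every $n\ge1$ and positive weights $a,b,c$, the dimer partition function of the Sierpiński graph $\Gamma_n$ with the "Schreier" labeling is $$\Phi_n(a,b,c)=\begin{cases}2\,(4abc)^{\frac{3^{n-1}-3}{4}}\,(abc+ab+ac+bc) & n \text{ even},\\ (4abc)^{\frac{3^{n-1}-1}{4}}\,(1+a+b+c) & n\text{ odd}.\end{cases}$$ Hence the number of dimer coverings of $\Gamma_n$ is $2^{\frac{3^{n-1}+3}{2}}$.
   Context: Let $a,b,c$ act on ternary words by the recursive rules, valid for any ternary word $w$: - $a(0w)=1w$, $a(1w)=0w$, $a(2w)=2a(w)$; - $b(0w)=2w$, $b(2w)=0w$, $b(1w)=1b(w)$; - $c(1w)=2w$, $c(2w)=1w$, $c(0w)=0c(w)$. These are the generators of the Hanoi Towers group. Let $\Sigma_n$ be the graph on $\{0,1,2\}^n$ with one edge labeled $s$ for each unordered pair $\{u,s(u)\}$, $s(u)\ne u$, $s\in\{a,b,c\}$; no loops are included. For each $w\in\{0,1,2\}^{n-1}$, the "elementary triangle" is formed by the vertices $0w,1w,2w$ and the edges $0w$–$1w$ (label $a$), $0w$–$2w$ (label $b$), and $1w$–$2w$ (label $c$). The Sierpiński graph $\Gamma_n$ with the "Schreier" labeling is obtained from $\Sigma_n$ by contracting every edge that does not belong to an elementary triangle; these edges form a matching. The remaining edges keep their labels. $\Gamma_n$ has $\frac32(3^{n-1}+1)$ vertices, and its three corners are the vertices $0^n,1^n,2^n$. A dimer covering of $\Gamma_n$ is a matching of $\Gamma_n$ covering every non-corner vertex, and - for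 $n$ odd, covering exactly zero or two corners; - for $n$ even, covering exactly one or three corners. With edges labeled $s$ given weight $s>0$, $\Phi_n(a,b,c)$ is the sum over dimer coverings of the product of the edge weights. -}

module Defs where

open import Data.Nat using (ℕ; zero; suc; _≡ᵇ_)
import Data.Nat as N
open import Data.Fin using (Fin; zero; suc)
import Data.Fin as Fin
open import Data.Vec using (Vec; []; _∷_; replicate)
import Data.Vec.Properties as VecP
open import Data.List using (List; []; _∷_; _++_; map; concatMap; filter; foldr; length)
open import Data.Bool using (Bool; true; false; _∧_; _∨_; not; if_then_else_)
open import Data.Product using (_×_; _,_; proj₁; proj₂)
open import Relation.Nullary using (does)
open import Algebra.Bundles using (CommutativeSemiring)
open import Level using (Level)

L : Set
L = Fin 3

l0 l1 l2 : L
l0 = zero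
l1 = suc zero
l2 = suc (suc zero)

Word : ℕ → Set
Word n = Vec L n

-- Generators of the Hanoi Towers group acting on ternary words
genA genB genC : ∀ {n} → Word n → Word n
genA [] = []
genA (zero ∷ w) = l1 ∷ w
genA (suc zero ∷ w) = l0 ∷ w
genA (suc (suc zero) ∷ w) = l2 ∷ genA w
genB [] = []
genB (zero ∷ w) = l2 ∷ w
genB (suc (suc zero) ∷ w) = l0 ∷ w
genB (suc zero ∷ w) = l1 ∷ genB w
genC [] = []
genC (suc zero ∷ w) = l2 ∷ w
genC (suc (suc zero) ∷ w) = l1 ∷ w
genC (zero ∷ w) = l0 ∷ genC w

-- label 0 = a, 1 = b, 2 = c
act : ∀ {n} → L → Word n → Word n
act zero = genA
act (suc zero) = genB
act (suc (suc zero)) = genC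

_==L_ : L → L → Bool
x ==L y = does (x Fin.≟ y)

_==W_ : ∀ {n} → Word n → Word n → Bool
u ==W v = does (VecP.≡-dec Fin._≟_ u v)

allLetters : List L
allLetters = l0 ∷ l1 ∷ l2 ∷ []

allWords : (n : ℕ) → List (Word n)
allWords zero = [] ∷ []
allWords (suc n) = concatMap (λ x → map (x ∷_) (allWords n)) allLetters

-- Elementary triangle edges of Σ_(suc m): indexed by (w, label):
-- label a : 0w – 1w,  label b : 0w – 2w,  label c : 1w – 2w
TriEdge : ℕ → Set
TriEdge m = Word m × L

ends : ∀ {m} → TriEdge m → Word (suc m) × Word (suc m)
ends (w , zero) = (l0 ∷ w) , (l1 ∷ w)
ends (w , suc zero) = (l0 ∷ w) , (l2 ∷ w)
ends (w , suc (suc zero)) = (l1 ∷ w) , (l2 ∷ w)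

allTriEdges : (m : ℕ) → List (TriEdge m)
allTriEdges m = concatMap (λ w → map (w ,_) allLetters) (allWords m)

isTriangleEdge : ∀ {m} → Word (suc m) → Word (suc m) → L → Bool
isTriangleEdge (x ∷ w) (y ∷ w') s =
  (w ==W w') ∧
  ((((x ==L l0) ∧ (y ==L l1)) ∨ ((x ==L l1) ∧ (y ==L l0))) ∧ (s ==L l0)
   ∨ (((x ==L l0) ∧ (y ==L l2)) ∨ ((x ==L l2) ∧ (y ==L l0))) ∧ (s ==L l1)
   ∨ (((x ==L l1) ∧ (y ==L l2)) ∨ ((x ==L l2) ∧ (y ==L l1))) ∧ (s ==L l2))

-- Vertices v ≠ u joined to u in Σ_(suc m) by an edge NOT in an elementary
-- triangle; these are contracted with u in Γ_(suc m).
partners : ∀ {m} → Word (suc m) → List (Word (suc m))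
partners u = map (λ s → act s u)
  (filter (λ s → not (act s u ==W u) ∧ not (isTriangleEdge u (act s u) s) Data.Bool.≟ true) allLetters)
  where import Data.Bool

-- a set of edges of Γ_(suc m) (= a subset of elementary triangle edges),
-- given as a sublist of allTriEdges m
sublists : ∀ {A : Set} → List A → List (List A)
sublists [] = [] ∷ []
sublists (x ∷ xs) = let r = sublists xs in r ++ map (x ∷_) r

incident : ∀ {m} → Word (suc m) → TriEdge m → Bool
incident u e = (u ==W proj₁ (ends e)) ∨ (u ==W proj₂ (ends e))

deg : ∀ {m} → List (TriEdge m) → Word (suc m) → ℕ
deg D u = length (filter (λ e → incident u e Data.Bool.≟ true) D)
  where import Data.Bool

-- degree in Γ_(suc m) of the (contracted) vertex containing u
classDeg : ∀ {m} → List (TriEdge m) → Word (suc m) → ℕ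
classDeg D u = deg D u N.+ foldr N._+_ 0 (map (deg D) (partners u))

corners : (n : ℕ) → List (Word n)
corners n = replicate n l0 ∷ replicate n l1 ∷ replicate n l2 ∷ []

isCorner : ∀ {n} → Word n → Bool
isCorner {n} u = foldr _∨_ false (map (u ==W_) (corners n))

allB : ∀ {A : Set} → (A → Bool) → List A → Bool
allB p = foldr (λ x r → p x ∧ r) true

leq1 : ℕ → Bool
leq1 zero = true
leq1 (suc zero) = true
leq1 (suc (suc _)) = false

isOdd : ℕ → Bool
isOdd zero = false
isOdd (suc n) = not (isOdd n)

coveredCorners : ∀ {m} → List (TriEdge m) → ℕ
coveredCorners {m} D = length (filter (λ u → (1 ≡ᵇ deg D u) Data.Bool.≟ true) (corners (suc m)))
  where import Data.Bool

isDimer : ∀ {m} → List (TriEdge m) → Bool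
isDimer {m} D =
  allB (λ u → leq1 (classDeg D u)) (allWords (suc m)) ∧
  allB (λ u → isCorner u ∨ (1 ≡ᵇ classDeg D u)) (allWords (suc m)) ∧
  (if isOdd (suc m)
     then ((coveredCorners D ≡ᵇ 0) ∨ (coveredCorners D ≡ᵇ 2))
     else ((coveredCorners D ≡ᵇ 1) ∨ (coveredCorners D ≡ᵇ 3)))

dimerCoverings : (m : ℕ) → List (List (TriEdge m))
dimerCoverings m = filter (λ D → isDimer D Data.Bool.≟ true) (sublists (allTriEdges m))
  where import Data.Bool

module _ {c ℓ : Level} (R : CommutativeSemiring c ℓ) where
  open CommutativeSemiring R using (Carrier; _+_; _*_; 0#; 1#)

  pow : Carrier → ℕ → Carrier
  pow x zero = 1#
  pow x (suc k) = x * pow x k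

  weight : Carrier → Carrier → Carrier → L → Carrier
  weight a b c zero = a
  weight a b c (suc zero) = b
  weight a b c (suc (suc zero)) = c

  -- Φ_(suc m)(a,b,c)
  Φ : (m : ℕ) → Carrier → Carrier → Carrier → Carrier
  Φ m a b c = foldr _+_ 0#
    (map (λ D → foldr _*_ 1# (map (λ e → weight a b c (proj₂ e)) D)) (dimerCoverings m))

module Submission where

-- An edge set of Γ_(m+1) chooses edges in each elementary triangle, and
-- whether it is a dimer covering depends only on the degree triples of the
-- triangles ("configurations", stored in ternary trees indexed by words).
-- So Φ is a tree sum of a covering indicator in which every triangle enters
-- through a linear leaf operator (DimerSum.Φ-as-Z).  Since Γ_(k+2) is Γ_(k+1)
-- with every triangle replaced by a block of three triangles, regrouping the
-- tree by its last letter (treeSum-unzip3) and pushing the block weights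
-- forward to the block corners (treeSum-push) turns the sum for Γ_(k+2) into
-- the sum for Γ_(k+1) with a coarsened leaf operator (renormalize).  A
-- triangle seen from its corners is in one of four states, coarsening acts
-- on their weights explicitly (coarsen-stateOp), and the weights
-- (4abc)^e (1, a, b, c) and 2 (4abc)^e (ab, ac, bc, abc) alternate
-- (blockWeights-pow).  After m steps one triangle remains, giving the
-- closed form; the count is its value at a = b = c = 1 in ℕ.

open import Level using (Level; _⊔_)
open import Algebra.Bundles using (CommutativeSemiring)
open import Data.Bool using (Bool; true; false; _∧_; _∨_; not; if_then_else_)
import Data.Bool as B
open import Data.Bool.Properties using (∧-assoc; ∧-zeroʳ; ∧-conicalˡ; ∧-conicalʳ; ⇔→≡; not-involutive)
open import Data.List.Properties using (++-identityʳ; concatMap-++; concatMap-map; map-cong)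
open import Data.List using (List; []; _∷_; _++_; map; filter; foldr; length; concatMap; cartesianProduct)
open import Data.Nat using (ℕ; zero; suc; _≡ᵇ_; _∸_; _^_; _/_; _%_)
import Data.Nat as N
open import Data.Fin using (zero; suc)
import Data.Fin as Fin
open import Relation.Nullary using (yes)
open import Function.Base using (_∘_)
open import Function.Bundles using (mk⇔)
open import Data.Product using (_×_; _,_; proj₁; proj₂)
open import Data.Vec using ([]; _∷_; replicate)
open import Relation.Binary.PropositionalEquality as P using (_≡_; refl)
import Data.Nat.Properties as ℕP
open import Data.Nat.DivMod using (m*n/n≡m; [m+n]%n≡m%n)
open import Data.Nat.Solver using (module +-*-Solver)

open import Defs

-- A tree of depth k with leaves in X is the same thing as a function
-- Word k → X; it is split at the first letter, like allWords.
Tree : ℕ → Set → Set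
Tree zero X = X
Tree (suc k) X = Tree k X × Tree k X × Tree k X

pick : {X : Set} → L → X × X × X → X
pick zero t = proj₁ t
pick (suc zero) t = proj₁ (proj₂ t)
pick (suc (suc zero)) t = proj₂ (proj₂ t)

map3 : {X Y : Set} → (X → Y) → X × X × X → Y × Y × Y
map3 f (x , y , z) = f x , f y , f z

at : ∀ {k} {X : Set} → Tree k X → Word k → X
at {zero} t [] = t
at {suc k} t (x ∷ w) = at (pick x t) w

mapT : ∀ {k} {X Y : Set} → (X → Y) → Tree k X → Tree k Y
mapT {zero} f t = f t
mapT {suc k} f t = map3 (mapT f) t

at-mapT : ∀ {k} {X Y : Set} (f : X → Y) (t : Tree k X) (w : Word k) → at (mapT f t) w ≡ f (at t w)
at-mapT {zero} f t [] = refl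
at-mapT {suc k} f t (zero ∷ w) = at-mapT f (pick l0 t) w
at-mapT {suc k} f t (suc zero ∷ w) = at-mapT f (pick l1 t) w
at-mapT {suc k} f t (suc (suc zero) ∷ w) = at-mapT f (pick l2 t) w

-- A tree of triples is a tree one level deeper, split at the LAST letter:
-- at (unzip3 g) (x ∷ w) is component x of at g w.
unzip3 : ∀ {k} {X : Set} → Tree k (X × X × X) → Tree (suc k) X
unzip3 g = mapT (pick l0) g , mapT (pick l1) g , mapT (pick l2) g

transpose3 : {X : Set} → (X × X × X) × (X × X × X) × (X × X × X) → (X × X × X) × (X × X × X) × (X × X × X)
transpose3 ((a0 , a1 , a2) , (b0 , b1 , b2) , (c0 , c1 , c2)) = (a0 , b0 , c0) , (a1 , b1 , c1) , (a2 , b2 , c2)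

module Summation {c ℓ : Level} (R : CommutativeSemiring c ℓ) where
  open CommutativeSemiring R hiding (zero) renaming (refl to ≈-refl)
  open import Relation.Binary.Reasoning.Setoid setoid

  Op : Set → Set c
  Op A = (A → Carrier) → Carrier

  _≋_ : {A : Set} → Op A → Op A → Set (c ⊔ ℓ)
  S ≋ V = ∀ F → S F ≈ V F

  record IsLinear {A : Set} (S : Op A) : Set (c ⊔ ℓ) where
    field
      cong : ∀ {F G} → (∀ x → F x ≈ G x) → S F ≈ S G
      0-hom : S (λ _ → 0#) ≈ 0#
      +-hom : ∀ F G → S (λ x → F x + G x) ≈ S F + S G
      *-hom : ∀ k F → S (λ x → k * F x) ≈ k * S F
  open IsLinear public

  Commute : {A B : Set} → Op A → Op B → Set (c ⊔ ℓ)
  Commute {A} {B} S V = ∀ (F : A → B → Carrier) → S (λ x → V (F x)) ≈ V (λ y → S (λ x → F x y))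

  Fubini : {A : Set} → Op A → Set (Level.suc Level.zero ⊔ c ⊔ ℓ)
  Fubini S = ∀ {B : Set} (V : Op B) → IsLinear V → Commute S V

  _⊗_ : {A B : Set} → Op A → Op B → Op (A × B)
  (S ⊗ V) F = S (λ x → V (λ y → F (x , y)))

  cube : {A : Set} → Op A → Op (A × A × A)
  cube S = S ⊗ (S ⊗ S)

  push : {A B : Set} → Op A → (A → Carrier) → (A → B) → Op B
  push S ω f G = S (λ x → ω x * G (f x))

  sumL : {A : Set} → List A → Op A
  sumL [] F = 0#
  sumL (x ∷ xs) F = F x + sumL xs F

  +-interchange : ∀ a b c d → (a + b) + (c + d) ≈ (a + c) + (b + d)
  +-interchange a b c d = begin
    (a + b) + (c + d) ≈⟨ +-assoc a b (c + d) ⟩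
    a + (b + (c + d)) ≈⟨ +-congˡ (sym (+-assoc b c d)) ⟩
    a + ((b + c) + d) ≈⟨ +-congˡ (+-congʳ (+-comm b c)) ⟩
    a + ((c + b) + d) ≈⟨ +-congˡ (+-assoc c b d) ⟩
    a + (c + (b + d)) ≈⟨ sym (+-assoc a c (b + d)) ⟩
    (a + c) + (b + d) ∎

  sumL-linear : {A : Set} (xs : List A) → IsLinear (sumL xs)
  sumL-linear xs = record { cong = cong′ xs ; 0-hom = zero′ xs ; +-hom = plus xs ; *-hom = times xs }
    where
    cong′ : ∀ xs {F G} → (∀ x → F x ≈ G x) → sumL xs F ≈ sumL xs G
    cong′ [] e = ≈-refl
    cong′ (x ∷ xs) e = +-cong (e x) (cong′ xs e)
    zero′ : ∀ xs → sumL xs (λ _ → 0#) ≈ 0#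
    zero′ [] = ≈-refl
    zero′ (x ∷ xs) = trans (+-identityˡ _) (zero′ xs)
    plus : ∀ xs F G → sumL xs (λ x → F x + G x) ≈ sumL xs F + sumL xs G
    plus [] F G = sym (+-identityˡ 0#)
    plus (x ∷ xs) F G = trans (+-congˡ (plus xs F G)) (+-interchange _ _ _ _)
    times : ∀ xs k F → sumL xs (λ x → k * F x) ≈ k * sumL xs F
    times [] k F = sym (zeroʳ k)
    times (x ∷ xs) k F = trans (+-congˡ (times xs k F)) (sym (distribˡ k _ _))

  sumL-fubini : {A : Set} (xs : List A) → Fubini (sumL xs)
  sumL-fubini [] V lin F = sym (0-hom lin)
  sumL-fubini (x ∷ xs) V lin F = trans (+-congˡ (sumL-fubini xs V lin F)) (sym (+-hom lin _ _))

  sumL-++ : {A : Set} (xs ys : List A) (F : A → Carrier) → sumL (xs ++ ys) F ≈ sumL xs F + sumL ys F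
  sumL-++ [] ys F = sym (+-identityˡ _)
  sumL-++ (x ∷ xs) ys F = trans (+-congˡ (sumL-++ xs ys F)) (sym (+-assoc _ _ _))

  sumL-map : {A B : Set} (f : A → B) (xs : List A) (F : B → Carrier) → sumL (map f xs) F ≡ sumL xs (λ x → F (f x))
  sumL-map f [] F = refl
  sumL-map f (x ∷ xs) F = P.cong (F (f x) +_) (sumL-map f xs F)

  sumL-cartesianProduct : {A B : Set} (xs : List A) (ys : List B) → sumL (cartesianProduct xs ys) ≋ (sumL xs ⊗ sumL ys)
  sumL-cartesianProduct [] ys F = ≈-refl
  sumL-cartesianProduct (x ∷ xs) ys F = begin
    sumL (map (x ,_) ys ++ cartesianProduct xs ys) F     ≈⟨ sumL-++ (map (x ,_) ys) _ F ⟩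
    sumL (map (x ,_) ys) F + sumL (cartesianProduct xs ys) F
                                                         ≈⟨ +-cong (reflexive (sumL-map (x ,_) ys F)) (sumL-cartesianProduct xs ys F) ⟩
    sumL ys (λ y → F (x , y)) + (sumL xs ⊗ sumL ys) F    ∎

  ind : Bool → Carrier
  ind true = 1#
  ind false = 0#

  ind-∧ : ∀ a b → ind (a ∧ b) ≈ ind a * ind b
  ind-∧ true b = sym (*-identityˡ _)
  ind-∧ false b = sym (zeroˡ _)

  sumL-filter : {A : Set} (b : A → Bool) (xs : List A) (F : A → Carrier) →
    sumL (filter (λ x → b x B.≟ true) xs) F ≈ sumL xs (λ x → F x * ind (b x))
  sumL-filter b [] F = ≈-refl
  sumL-filter b (x ∷ xs) F with b x
  ... | true = +-cong (sym (*-identityʳ _)) (sumL-filter b xs F)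
  ... | false = trans (sumL-filter b xs F) (sym (trans (+-congʳ (zeroʳ _)) (+-identityˡ _)))

  ⊗-linear : {A B : Set} {S : Op A} {V : Op B} → IsLinear S → IsLinear V → IsLinear (S ⊗ V)
  ⊗-linear linS linV = record
    { cong = λ e → cong linS (λ x → cong linV (λ y → e (x , y)))
    ; 0-hom = trans (cong linS (λ _ → 0-hom linV)) (0-hom linS)
    ; +-hom = λ F G → trans (cong linS (λ x → +-hom linV _ _)) (+-hom linS _ _)
    ; *-hom = λ k F → trans (cong linS (λ x → *-hom linV k _)) (*-hom linS k _)
    }

  cube-linear : {A : Set} {S : Op A} → IsLinear S → IsLinear (cube S)
  cube-linear lin = ⊗-linear lin (⊗-linear lin lin)

  push-linear : {A B : Set} {S : Op A} (ω : A → Carrier) (f : A → B) → IsLinear S → IsLinear (push S ω f)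
  push-linear ω f lin = record
    { cong = λ e → cong lin (λ x → *-congˡ (e (f x)))
    ; 0-hom = trans (cong lin (λ x → zeroʳ (ω x))) (0-hom lin)
    ; +-hom = λ F G → trans (cong lin (λ x → distribˡ (ω x) _ _)) (+-hom lin _ _)
    ; *-hom = λ k F → trans (cong lin (λ x → x*[k*y]≈k*[x*y] (ω x) k _)) (*-hom lin k _)
    }
    where
    x*[k*y]≈k*[x*y] : ∀ x k y → x * (k * y) ≈ k * (x * y)
    x*[k*y]≈k*[x*y] x k y = trans (sym (*-assoc x k y)) (trans (*-congʳ (*-comm x k)) (*-assoc k x y))

  ⊗-fubini : {A B : Set} {S : Op A} {V : Op B} → IsLinear S → Fubini S → Fubini V → Fubini (S ⊗ V)
  ⊗-fubini linS fubS fubV W linW F =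
    trans (cong linS (λ x → fubV W linW (λ y → F (x , y)))) (fubS W linW _)

  cube-fubini : {A : Set} {S : Op A} → IsLinear S → Fubini S → Fubini (cube S)
  cube-fubini {S = S} lin fub = ⊗-fubini {S = S} {S ⊗ S} lin fub (⊗-fubini {S = S} {S} lin fub fub)

  push-fubini : {A B : Set} {S : Op A} (ω : A → Carrier) (f : A → B) → IsLinear S → Fubini S → Fubini (push S ω f)
  push-fubini ω f lin fub W linW F =
    trans (cong lin (λ x → sym (*-hom linW (ω x) (F (f x))))) (fub W linW _)

  ⊗-resp : {A B : Set} {S S′ : Op A} {V V′ : Op B} → IsLinear S → S ≋ S′ → V ≋ V′ → (S ⊗ V) ≋ (S′ ⊗ V′)
  ⊗-resp linS eS eV F = trans (cong linS (λ x → eV _)) (eS _)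

  cube-resp : {A : Set} {S S′ : Op A} → IsLinear S → S ≋ S′ → cube S ≋ cube S′
  cube-resp lin e = ⊗-resp lin e (⊗-resp lin e e)

  push-⊗ : {A B C D : Set} {S : Op A} {V : Op B} (ω : A → Carrier) (ω′ : B → Carrier) (f : A → C) (g : B → D) →
    IsLinear S → IsLinear V →
    push (S ⊗ V) (λ p → ω (proj₁ p) * ω′ (proj₂ p)) (λ p → f (proj₁ p) , g (proj₂ p)) ≋ (push S ω f ⊗ push V ω′ g)
  push-⊗ ω ω′ f g linS linV G =
    cong linS (λ x → trans (cong linV (λ y → *-assoc (ω x) (ω′ y) _)) (*-hom linV (ω x) _))

  weight³ : {A : Set} → (A → Carrier) → A × A × A → Carrier
  weight³ ω (x , y , z) = ω x * (ω y * ω z)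

  push-cube : {A B : Set} {S : Op A} (ω : A → Carrier) (f : A → B) → IsLinear S →
    push (cube S) (weight³ ω) (map3 f) ≋ cube (push S ω f)
  push-cube ω f lin G = trans (push-⊗ ω _ f _ lin (⊗-linear lin lin) G)
    (⊗-resp (push-linear ω f lin) (λ _ → ≈-refl) (push-⊗ ω ω f f lin lin) G)

  -- Summing over a 3×3 array of variables with a self-commuting operator is
  -- invariant under transposing the array: bubble the nine sums into order
  -- by nine adjacent interchanges.
  cube-transpose : {A : Set} {U : Op A} → IsLinear U → Commute U U →
    (F : (A × A × A) × (A × A × A) × (A × A × A) → Carrier) → cube (cube U) (λ t → F (transpose3 t)) ≈ cube (cube U) F
  cube-transpose {A} {U} lin sw F =
    trans (C λ a0 → C λ a1 → sw _)                                       -- b0 past a2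
    (trans (C λ a0 → sw _)                                               -- b0 past a1
    (trans (C λ a0 → C λ b0 → C λ a1 → C λ a2 → C λ b1 → sw _)           -- c0 past b2
    (trans (C λ a0 → C λ b0 → C λ a1 → C λ a2 → sw _)                    -- c0 past b1
    (trans (C λ a0 → C λ b0 → C λ a1 → sw _)                             -- c0 past a2
    (trans (C λ a0 → C λ b0 → sw _)                                      -- c0 past a1
    (trans (C λ a0 → C λ b0 → C λ c0 → C λ a1 → sw _)                    -- b1 past a2
    (trans (C λ a0 → C λ b0 → C λ c0 → C λ a1 → C λ b1 → C λ a2 → sw _)  -- c1 past b2
           (C λ a0 → C λ b0 → C λ c0 → C λ a1 → C λ b1 → sw _))))))))    -- c1 past a2
    where
    C : ∀ {F G : A → Carrier} → (∀ x → F x ≈ G x) → U F ≈ U G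
    C = cong lin

  treeSum : ∀ k {X : Set} → Op X → Op (Tree k X)
  treeSum zero S = S
  treeSum (suc k) S = cube (treeSum k S)

  treeSum-linear : ∀ k {X : Set} {S : Op X} → IsLinear S → IsLinear (treeSum k S)
  treeSum-linear zero lin = lin
  treeSum-linear (suc k) lin = cube-linear (treeSum-linear k lin)

  treeSum-fubini : ∀ k {X : Set} {S : Op X} → IsLinear S → Fubini S → Fubini (treeSum k S)
  treeSum-fubini zero lin fub = fub
  treeSum-fubini (suc k) {S = S} lin fub = cube-fubini {S = treeSum k S} (treeSum-linear k lin) (treeSum-fubini k lin fub)

  treeSum-resp : ∀ k {X : Set} {S S′ : Op X} → IsLinear S → S ≋ S′ → treeSum k S ≋ treeSum k S′
  treeSum-resp zero lin e = e
  treeSum-resp (suc k) lin e = cube-resp (treeSum-linear k lin) (treeSum-resp k lin e)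

  prodT : ∀ {k} {X : Set} → (X → Carrier) → Tree k X → Carrier
  prodT {zero} ω t = ω t
  prodT {suc k} ω t = weight³ (prodT ω) t

  treeSum-push : ∀ k {X Y : Set} {S : Op X} (ω : X → Carrier) (f : X → Y) → IsLinear S →
    push (treeSum k S) (prodT ω) (mapT f) ≋ treeSum k (push S ω f)
  treeSum-push zero ω f lin G = ≈-refl
  treeSum-push (suc k) ω f lin G =
    trans (push-cube (prodT ω) (mapT f) (treeSum-linear k lin) G)
          (cube-resp (push-linear (prodT ω) (mapT f) (treeSum-linear k lin)) (treeSum-push k ω f lin) G)

  treeSum-unzip3 : ∀ k {X : Set} {S : Op X} → IsLinear S → Fubini S → (F : Tree (suc k) X → Carrier) →
    treeSum k (cube S) (λ g → F (unzip3 g)) ≈ treeSum (suc k) S F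
  treeSum-unzip3 zero lin fub F = ≈-refl
  treeSum-unzip3 (suc k) {S = S} lin fub F =
    trans (C λ g0 → C λ g1 → IH (λ u2 → F (transpose3 (unzip3 g0 , unzip3 g1 , u2))))
    (trans (C λ g0 → IH (λ u1 → treeSum (suc k) S (λ u2 → F (transpose3 (unzip3 g0 , u1 , u2)))))
    (trans (IH (λ u0 → treeSum (suc k) S (λ u1 → treeSum (suc k) S (λ u2 → F (transpose3 (u0 , u1 , u2))))))
           (cube-transpose (treeSum-linear k lin) (treeSum-fubini k lin fub (treeSum k S) (treeSum-linear k lin)) F)))
    where
    IH = treeSum-unzip3 k lin fub
    C = cong (treeSum-linear k (cube-linear lin))

allB-++ : {A : Set} (p : A → Bool) (xs ys : List A) → allB p (xs ++ ys) ≡ (allB p xs ∧ allB p ys)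
allB-++ p [] ys = refl
allB-++ p (x ∷ xs) ys = P.trans (P.cong (p x ∧_) (allB-++ p xs ys)) (P.sym (∧-assoc (p x) _ _))

allB-map : {A B : Set} (p : A → Bool) (f : B → A) (xs : List B) → allB p (map f xs) ≡ allB (λ x → p (f x)) xs
allB-map p f [] = refl
allB-map p f (x ∷ xs) = P.cong (p (f x) ∧_) (allB-map p f xs)

allB-cong : {A : Set} {p q : A → Bool} (xs : List A) → (∀ x → p x ≡ q x) → allB p xs ≡ allB q xs
allB-cong [] e = refl
allB-cong (x ∷ xs) e = P.cong₂ _∧_ (e x) (allB-cong xs e)

allB-∧ : {A : Set} (p q : A → Bool) (xs : List A) → allB (λ x → p x ∧ q x) xs ≡ (allB p xs ∧ allB q xs)
allB-∧ p q [] = refl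
allB-∧ p q (x ∷ xs) = begin
  (p x ∧ q x) ∧ allB (λ x → p x ∧ q x) xs  ≡⟨ P.cong ((p x ∧ q x) ∧_) (allB-∧ p q xs) ⟩
  (p x ∧ q x) ∧ (allB p xs ∧ allB q xs)    ≡⟨ ∧-interchange (p x) (q x) _ _ ⟩
  (p x ∧ allB p xs) ∧ (q x ∧ allB q xs)    ∎
  where
  open P.≡-Reasoning
  ∧-interchange : ∀ a b c d → (a ∧ b) ∧ (c ∧ d) ≡ (a ∧ c) ∧ (b ∧ d)
  ∧-interchange false b c d = refl
  ∧-interchange true b false d = ∧-zeroʳ b
  ∧-interchange true b true d = refl

allWords-split : ∀ k (p : Word (suc k) → Bool) → allB p (allWords (suc k)) ≡
  (allB (λ w → p (l0 ∷ w)) (allWords k) ∧ (allB (λ w → p (l1 ∷ w)) (allWords k) ∧ allB (λ w → p (l2 ∷ w)) (allWords k)))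
allWords-split k p = begin
  allB p (map (l0 ∷_) A ++ (map (l1 ∷_) A ++ (map (l2 ∷_) A ++ [])))
    ≡⟨ allB-++ p (map (l0 ∷_) A) _ ⟩
  allB p (map (l0 ∷_) A) ∧ allB p (map (l1 ∷_) A ++ (map (l2 ∷_) A ++ []))
    ≡⟨ P.cong (allB p (map (l0 ∷_) A) ∧_) (allB-++ p (map (l1 ∷_) A) _) ⟩
  allB p (map (l0 ∷_) A) ∧ (allB p (map (l1 ∷_) A) ∧ allB p (map (l2 ∷_) A ++ []))
    ≡⟨ P.cong₂ (λ u v → u ∧ (allB p (map (l1 ∷_) A) ∧ v)) (allB-map p (l0 ∷_) A)
                (P.trans (P.cong (allB p) (++-identityʳ (map (l2 ∷_) A))) (allB-map p (l2 ∷_) A)) ⟩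
  allB (λ w → p (l0 ∷ w)) A ∧ (allB p (map (l1 ∷_) A) ∧ allB (λ w → p (l2 ∷ w)) A)
    ≡⟨ P.cong (λ v → allB (λ w → p (l0 ∷ w)) A ∧ (v ∧ allB (λ w → p (l2 ∷ w)) A)) (allB-map p (l1 ∷_) A) ⟩
  allB (λ w → p (l0 ∷ w)) A ∧ (allB (λ w → p (l1 ∷ w)) A ∧ allB (λ w → p (l2 ∷ w)) A) ∎
  where
  open P.≡-Reasoning
  A = allWords k

allWords-sound : ∀ k (p : Word k → Bool) → allB p (allWords k) ≡ true → ∀ w → p w ≡ true
allWords-sound zero p e [] = ∧-conicalˡ _ _ e
allWords-sound (suc k) p e (x ∷ w) = on x (P.subst (_≡ true) (allWords-split k p) e)
  where
  block : L → Bool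
  block y = allB (λ v → p (y ∷ v)) (allWords k)
  on : ∀ x → (block l0 ∧ (block l1 ∧ block l2)) ≡ true → p (x ∷ w) ≡ true
  on zero e′ = allWords-sound k _ (∧-conicalˡ (block l0) _ e′) w
  on (suc zero) e′ = allWords-sound k _ (∧-conicalˡ (block l1) _ (∧-conicalʳ (block l0) _ e′)) w
  on (suc (suc zero)) e′ = allWords-sound k _ (∧-conicalʳ (block l1) _ (∧-conicalʳ (block l0) _ e′)) w

allWords-complete : ∀ k (p : Word k → Bool) → (∀ w → p w ≡ true) → allB p (allWords k) ≡ true
allWords-complete zero p h = P.cong (_∧ true) (h [])
allWords-complete (suc k) p h = P.trans (allWords-split k p)
  (P.cong₂ _∧_ (allWords-complete k _ (λ w → h (l0 ∷ w)))
    (P.cong₂ _∧_ (allWords-complete k _ (λ w → h (l1 ∷ w))) (allWords-complete k _ (λ w → h (l2 ∷ w)))))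

==L-sound : ∀ {x y} → (x ==L y) ≡ true → x ≡ y
==L-sound {x} {y} e with x Fin.≟ y
... | yes x≡y = x≡y

-- The numbers of chosen edges at the vertices 0w, 1w, 2w of a triangle.
Degrees : Set
Degrees = ℕ × ℕ × ℕ

-- A configuration of Γ_(k+1) records the degree triple of every
-- elementary triangle, indexed by the common suffix w of its vertices.
Config : ℕ → Set
Config k = Tree k Degrees

degreeIn : ∀ {k} → Config k → Word (suc k) → ℕ
degreeIn η (x ∷ w) = pick x (at η w)

-- The generator that moves x ∷ w out of its elementary triangle.
crossGen : L → L
crossGen zero = l2
crossGen (suc zero) = l1
crossGen (suc (suc zero)) = l0

-- The vertex contracted with u in Γ, if any (this is what `partners` computes).
partnersOf : ∀ {k} → Word (suc k) → List (Word (suc k))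
partnersOf (x ∷ w) = if act (crossGen x) w ==W w then [] else (x ∷ act (crossGen x) w) ∷ []

classDegreeIn : ∀ {k} → Config k → Word (suc k) → ℕ
classDegreeIn η u = degreeIn η u N.+ foldr N._+_ 0 (map (degreeIn η) (partnersOf u))

vertexCondition : Bool → ℕ → Bool
vertexCondition corner d = leq1 d ∧ (corner ∨ (1 ≡ᵇ d))

vertexOK : ∀ {k} → Config k → Word (suc k) → Bool
vertexOK η u = vertexCondition (isCorner u) (classDegreeIn η u)

countOnes : List ℕ → ℕ
countOnes ns = length (filter (λ n → (1 ≡ᵇ n) B.≟ true) ns)

cornersCovered : ∀ {k} → Config k → ℕ
cornersCovered {k} η = countOnes (map (degreeIn η) (corners (suc k)))

isCovering : ∀ k → (ℕ → Bool) → Config k → Bool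
isCovering k Q η = allB (vertexOK η) (allWords (suc k)) ∧ Q (cornersCovered η)

-- Γ_(k+2) is Γ_(k+1) with every triangle replaced by a block of three
-- triangles, so a configuration of Γ_(k+2) is unzip3 h for a tree h of
-- blocks.  The corners x ∷ x ∷ w of a block become the vertices x ∷ w.
Block : Set
Block = Degrees × Degrees × Degrees

-- The degree triple of the corners x ∷ x ∷ [] of a block, where
-- pick x (pick y t) is the degree of x ∷ y ∷ [].
blockCorners : Block → Degrees
blockCorners t = pick l0 (pick l0 t) , pick l1 (pick l1 t) , pick l2 (pick l2 t)

innerOK : Block → Word 2 → Bool
innerOK t (x ∷ y ∷ []) = (x ==L y) ∨ vertexOK t (x ∷ y ∷ [])

blockOK : Block → Bool
blockOK t = allB (innerOK t) (allWords 2)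

module Coarse {k : ℕ} (h : Tree k Block) where

  degree-unzip3 : ∀ x y w → degreeIn (unzip3 h) (x ∷ y ∷ w) ≡ pick x (pick y (at h w))
  degree-unzip3 x zero w = P.cong (pick x) (at-mapT (pick l0) h w)
  degree-unzip3 x (suc zero) w = P.cong (pick x) (at-mapT (pick l1) h w)
  degree-unzip3 x (suc (suc zero)) w = P.cong (pick x) (at-mapT (pick l2) h w)

  degree-corners : ∀ x w → degreeIn (mapT blockCorners h) (x ∷ w) ≡ pick x (pick x (at h w))
  degree-corners zero w = P.cong (pick l0) (at-mapT blockCorners h w)
  degree-corners (suc zero) w = P.cong (pick l1) (at-mapT blockCorners h w)
  degree-corners (suc (suc zero)) w = P.cong (pick l2) (at-mapT blockCorners h w)

  sameDegree : ∀ x w → degreeIn (unzip3 h) (x ∷ x ∷ w) ≡ degreeIn (mapT blockCorners h) (x ∷ w)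
  sameDegree x w = P.trans (degree-unzip3 x x w) (P.sym (degree-corners x w))

  inBlock : ∀ x y y′ w → degreeIn (unzip3 h) (x ∷ y ∷ w) N.+ (degreeIn (unzip3 h) (x ∷ y′ ∷ w) N.+ 0)
                       ≡ pick x (pick y (at h w)) N.+ (pick x (pick y′ (at h w)) N.+ 0)
  inBlock x y y′ w = P.cong₂ (λ d e → d N.+ (e N.+ 0)) (degree-unzip3 x y w) (degree-unzip3 x y′ w)

  -- An inner vertex x ∷ y ∷ w (x ≠ y) and its partner x ∷ y′ ∷ w lie in
  -- the block at w, and it is not a corner.
  classDegree-inner : ∀ x y w → (x ==L y) ≡ false → classDegreeIn (unzip3 h) (x ∷ y ∷ w) ≡ classDegreeIn (at h w) (x ∷ y ∷ [])
  classDegree-inner zero (suc zero) w _ = inBlock l0 l1 l2 w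
  classDegree-inner zero (suc (suc zero)) w _ = inBlock l0 l2 l1 w
  classDegree-inner (suc zero) zero w _ = inBlock l1 l0 l2 w
  classDegree-inner (suc zero) (suc (suc zero)) w _ = inBlock l1 l2 l0 w
  classDegree-inner (suc (suc zero)) zero w _ = inBlock l2 l0 l1 w
  classDegree-inner (suc (suc zero)) (suc zero) w _ = inBlock l2 l1 l0 w
  classDegree-inner zero zero w ()
  classDegree-inner (suc zero) (suc zero) w ()
  classDegree-inner (suc (suc zero)) (suc (suc zero)) w ()

  isCorner-inner : ∀ x y (w : Word k) → (x ==L y) ≡ false → isCorner (x ∷ y ∷ w) ≡ isCorner (x ∷ y ∷ [])
  isCorner-inner zero (suc zero) w _ = refl
  isCorner-inner zero (suc (suc zero)) w _ = refl
  isCorner-inner (suc zero) zero w _ = refl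
  isCorner-inner (suc zero) (suc (suc zero)) w _ = refl
  isCorner-inner (suc (suc zero)) zero w _ = refl
  isCorner-inner (suc (suc zero)) (suc zero) w _ = refl
  isCorner-inner zero zero w ()
  isCorner-inner (suc zero) (suc zero) w ()
  isCorner-inner (suc (suc zero)) (suc (suc zero)) w ()

  vertexOK-inner : ∀ x y w → (x ==L y) ≡ false → vertexOK (unzip3 h) (x ∷ y ∷ w) ≡ vertexOK (at h w) (x ∷ y ∷ [])
  vertexOK-inner x y w x≠y = P.cong₂ vertexCondition (isCorner-inner x y w x≠y) (classDegree-inner x y w x≠y)

  classDegree-corner : ∀ x w → classDegreeIn (unzip3 h) (x ∷ x ∷ w) ≡ classDegreeIn (mapT blockCorners h) (x ∷ w)
  classDegree-corner zero w with act l2 w ==W w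
  ... | true = P.cong (N._+ 0) (sameDegree l0 w)
  ... | false = P.cong₂ (λ d e → d N.+ (e N.+ 0)) (sameDegree l0 w) (sameDegree l0 (act l2 w))
  classDegree-corner (suc zero) w with act l1 w ==W w
  ... | true = P.cong (N._+ 0) (sameDegree l1 w)
  ... | false = P.cong₂ (λ d e → d N.+ (e N.+ 0)) (sameDegree l1 w) (sameDegree l1 (act l1 w))
  classDegree-corner (suc (suc zero)) w with act l0 w ==W w
  ... | true = P.cong (N._+ 0) (sameDegree l2 w)
  ... | false = P.cong₂ (λ d e → d N.+ (e N.+ 0)) (sameDegree l2 w) (sameDegree l2 (act l0 w))

  isCorner-corner : ∀ x (w : Word k) → isCorner (x ∷ x ∷ w) ≡ isCorner (x ∷ w)
  isCorner-corner zero w = refl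
  isCorner-corner (suc zero) w = refl
  isCorner-corner (suc (suc zero)) w = refl

  vertexOK-corner : ∀ x w → vertexOK (unzip3 h) (x ∷ x ∷ w) ≡ vertexOK (mapT blockCorners h) (x ∷ w)
  vertexOK-corner x w = P.cong₂ vertexCondition (isCorner-corner x w) (classDegree-corner x w)

  -- The corners of Γ_(k+2) are corners of blocks, so the coarse configuration
  -- covers the same corners.
  cornersCovered-unzip3 : cornersCovered {suc k} (unzip3 h) ≡ cornersCovered {k} (mapT blockCorners h)
  cornersCovered-unzip3 = P.cong countOnes (P.cong₂ _∷_ (sameDegree l0 (replicate k l0))
    (P.cong₂ _∷_ (sameDegree l1 (replicate k l1)) (P.cong (_∷ []) (sameDegree l2 (replicate k l2)))))

  vertexOK-unzip3 : allB (vertexOK (unzip3 h)) (allWords (suc (suc k)))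
                  ≡ allB (λ w → blockOK (at h w)) (allWords k) ∧ allB (vertexOK (mapT blockCorners h)) (allWords (suc k))
  vertexOK-unzip3 = ⇔→≡ (mk⇔ fine⇒coarse coarse⇒fine)
    where
    fine⇒coarse : allB (vertexOK (unzip3 h)) (allWords (suc (suc k))) ≡ true →
                  (allB (λ w → blockOK (at h w)) (allWords k) ∧ allB (vertexOK (mapT blockCorners h)) (allWords (suc k))) ≡ true
    fine⇒coarse e = P.cong₂ _∧_
      (allWords-complete k _ (λ w → allWords-complete 2 (innerOK (at h w)) (λ { (x ∷ y ∷ []) → inner x y w })))
      (allWords-complete (suc k) _ (λ { (x ∷ w) → P.trans (P.sym (vertexOK-corner x w)) (fine (x ∷ x ∷ w)) }))
      where
      fine = allWords-sound (suc (suc k)) _ e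
      inner : ∀ x y w → innerOK (at h w) (x ∷ y ∷ []) ≡ true
      inner x y w with x ==L y in x≟y
      ... | true = refl
      ... | false = P.trans (P.sym (vertexOK-inner x y w x≟y)) (fine (x ∷ y ∷ w))
    coarse⇒fine : (allB (λ w → blockOK (at h w)) (allWords k) ∧ allB (vertexOK (mapT blockCorners h)) (allWords (suc k))) ≡ true →
                  allB (vertexOK (unzip3 h)) (allWords (suc (suc k))) ≡ true
    coarse⇒fine e = allWords-complete (suc (suc k)) _ (λ { (x ∷ y ∷ w) → fine x y w })
      where
      blocks = allWords-sound k _ (∧-conicalˡ _ _ e)
      coarse = allWords-sound (suc k) _ (∧-conicalʳ (allB (λ w → blockOK (at h w)) (allWords k)) _ e)
      fine : ∀ x y w → vertexOK (unzip3 h) (x ∷ y ∷ w) ≡ true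
      fine x y w with x ==L y in x≟y
      ... | true with refl ← ==L-sound {x} {y} x≟y = P.trans (vertexOK-corner x w) (coarse (x ∷ w))
      ... | false = P.trans (vertexOK-inner x y w x≟y)
                            (P.subst (λ b → (b ∨ vertexOK (at h w) (x ∷ y ∷ [])) ≡ true) x≟y
                                     (allWords-sound 2 (innerOK (at h w)) (blocks w) (x ∷ y ∷ [])))

  isCovering-unzip3 : ∀ Q → isCovering (suc k) Q (unzip3 h)
                      ≡ allB (λ w → blockOK (at h w)) (allWords k) ∧ isCovering k Q (mapT blockCorners h)
  isCovering-unzip3 Q = P.trans (P.cong₂ _∧_ vertexOK-unzip3 (P.cong Q cornersCovered-unzip3))
                                (∧-assoc (allB (λ w → blockOK (at h w)) (allWords k)) _ _)

module Renormalization {c ℓ : Level} (R : CommutativeSemiring c ℓ) where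
  open CommutativeSemiring R hiding (zero) renaming (refl to ≈-refl)
  open Summation R
  open import Relation.Binary.Reasoning.Setoid setoid

  Z : ∀ k → Op Degrees → (ℕ → Bool) → Carrier
  Z k μ Q = treeSum k μ (λ η → ind (isCovering k Q η))

  Z-resp : ∀ k {μ μ′ : Op Degrees} → IsLinear μ → μ ≋ μ′ → ∀ Q → Z k μ Q ≈ Z k μ′ Q
  Z-resp k lin e Q = treeSum-resp k lin e _

  ind-allB : ∀ k {X : Set} (b : X → Bool) (t : Tree k X) →
    ind (allB (λ w → b (at t w)) (allWords k)) ≈ prodT (λ x → ind (b x)) t
  ind-allB zero b t = trans (ind-∧ (b t) true) (*-identityʳ _)
  ind-allB (suc k) b t = begin
    ind (allB (λ w → b (at t w)) (allWords (suc k)))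
      ≡⟨ P.cong ind (allWords-split k (λ w → b (at t w))) ⟩
    ind (leaves l0 ∧ (leaves l1 ∧ leaves l2))
      ≈⟨ trans (ind-∧ (leaves l0) _) (*-congˡ (ind-∧ (leaves l1) _)) ⟩
    ind (leaves l0) * (ind (leaves l1) * ind (leaves l2))
      ≈⟨ *-cong (ind-allB k b (pick l0 t)) (*-cong (ind-allB k b (pick l1 t)) (ind-allB k b (pick l2 t))) ⟩
    prodT (λ x → ind (b x)) t ∎
    where
    leaves : L → Bool
    leaves x = allB (λ w → b (at (pick x t) w)) (allWords k)

  coarsen : Op Degrees → Op Degrees
  coarsen μ = push (cube μ) (λ t → ind (blockOK t)) blockCorners

  renormalize : ∀ k {μ : Op Degrees} → IsLinear μ → Fubini μ → ∀ Q → Z (suc k) μ Q ≈ Z k (coarsen μ) Q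
  renormalize k {μ} lin fub Q = begin
    treeSum (suc k) μ (λ η → ind (isCovering (suc k) Q η))
      ≈⟨ sym (treeSum-unzip3 k lin fub _) ⟩
    treeSum k (cube μ) (λ h → ind (isCovering (suc k) Q (unzip3 h)))
      ≈⟨ cong (treeSum-linear k (cube-linear lin)) split ⟩
    push (treeSum k (cube μ)) (prodT (λ t → ind (blockOK t))) (mapT blockCorners) (λ η → ind (isCovering k Q η))
      ≈⟨ treeSum-push k (λ t → ind (blockOK t)) blockCorners (cube-linear lin) _ ⟩
    Z k (coarsen μ) Q ∎
    where
    split : ∀ h → ind (isCovering (suc k) Q (unzip3 h)) ≈ prodT (λ t → ind (blockOK t)) h * ind (isCovering k Q (mapT blockCorners h))
    split h = begin
      ind (isCovering (suc k) Q (unzip3 h))  ≡⟨ P.cong ind (Coarse.isCovering-unzip3 h Q) ⟩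
      ind (allB (λ w → blockOK (at h w)) (allWords k) ∧ isCovering k Q (mapT blockCorners h))
                                             ≈⟨ ind-∧ (allB (λ w → blockOK (at h w)) (allWords k)) _ ⟩
      _                                      ≈⟨ *-congʳ (ind-allB k blockOK h) ⟩
      prodT (λ t → ind (blockOK t)) h * ind (isCovering k Q (mapT blockCorners h)) ∎

  renormalize-iterate : ∀ k (μs : ℕ → Op Degrees) → (∀ i → IsLinear (μs i)) → (∀ i → Fubini (μs i)) →
    (∀ i → coarsen (μs i) ≋ μs (suc i)) → ∀ Q → Z k (μs 0) Q ≈ Z 0 (μs k) Q
  renormalize-iterate zero μs lin fub step Q = ≈-refl
  renormalize-iterate (suc k) μs lin fub step Q = begin
    Z (suc k) (μs 0) Q          ≈⟨ renormalize k (lin 0) (fub 0) Q ⟩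
    Z k (coarsen (μs 0)) Q      ≈⟨ Z-resp k (push-linear _ blockCorners (cube-linear (lin 0))) (step 0) Q ⟩
    Z k (μs 1) Q                ≈⟨ renormalize-iterate k (λ i → μs (suc i)) (λ i → lin (suc i)) (λ i → fub (suc i)) (λ i → step (suc i)) Q ⟩
    Z 0 (μs (suc k)) Q          ∎

-- Seen from its three corners, a triangle (or a block of any depth) is in
-- one of four states.  At even depth (parity true) the states cover no corner
-- or the two ends of an edge a, b, c; at odd depth they cover one corner or
-- all three.
data State : Set where
  s0 s1 s2 s3 : State

states : List State
states = s0 ∷ s1 ∷ s2 ∷ s3 ∷ []

cornerDegrees : Bool → State → Degrees
cornerDegrees true s0 = 0 , 0 , 0
cornerDegrees true s1 = 1 , 1 , 0
cornerDegrees true s2 = 1 , 0 , 1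
cornerDegrees true s3 = 0 , 1 , 1
cornerDegrees false s0 = 1 , 0 , 0
cornerDegrees false s1 = 0 , 1 , 0
cornerDegrees false s2 = 0 , 0 , 1
cornerDegrees false s3 = 1 , 1 , 1

module States {c ℓ : Level} (R : CommutativeSemiring c ℓ) where
  open CommutativeSemiring R hiding (zero) renaming (refl to ≈-refl)
  open Summation R
  open Renormalization R
  open import Relation.Binary.Reasoning.Setoid setoid
  import Algebra.Solver.Ring.NaturalCoefficients.Default R as Solver
  open Solver using (_:+_; _:*_; _:=_; con)

  stateOp : Bool → (State → Carrier) → Op Degrees
  stateOp parity v = push (sumL states) v (cornerDegrees parity)

  stateOp-linear : ∀ parity v → IsLinear (stateOp parity v)
  stateOp-linear parity v = push-linear v (cornerDegrees parity) (sumL-linear states)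

  stateOp-fubini : ∀ parity v → Fubini (stateOp parity v)
  stateOp-fubini parity v = push-fubini v (cornerDegrees parity) (sumL-linear states) (sumL-fubini states)

  stateOp-resp : ∀ parity {v v′ : State → Carrier} → (∀ s → v s ≈ v′ s) → stateOp parity v ≋ stateOp parity v′
  stateOp-resp parity {v} {v′} e G =
    cong (sumL-linear states) {λ s → v s * G (cornerDegrees parity s)} {λ s → v′ s * G (cornerDegrees parity s)} (λ s → *-congʳ (e s))

  -- The weight of each state of a block, given the weights of its three
  -- sub-triangles: the two ways of realising the state.
  blockWeights : (State → Carrier) → State → Carrier
  blockWeights v s0 = weight³ v (s1 , s2 , s0) + weight³ v (s2 , s0 , s1)
  blockWeights v s1 = weight³ v (s0 , s3 , s1) + weight³ v (s3 , s1 , s0)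
  blockWeights v s2 = weight³ v (s0 , s2 , s3) + weight³ v (s3 , s0 , s2)
  blockWeights v s3 = weight³ v (s1 , s3 , s2) + weight³ v (s2 , s1 , s3)

  sumL-triples : {A : Set} (xs : List A) → sumL (cartesianProduct xs (cartesianProduct xs xs)) ≋ cube (sumL xs)
  sumL-triples xs F = trans (sumL-cartesianProduct xs _ F)
    (⊗-resp (sumL-linear xs) (λ _ → ≈-refl) (sumL-cartesianProduct xs xs) F)

  -- Of the 64 state triples of a block exactly 8 satisfy the inner
  -- conditions, two for each state of the block, with the parity flipped.
  coarsen-stateOp : ∀ parity v → coarsen (stateOp parity v) ≋ stateOp (not parity) (blockWeights v)
  coarsen-stateOp parity v G = begin
    cube (stateOp parity v) (λ t → ind (blockOK t) * G (blockCorners t))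
      ≈⟨ sym (push-cube v cd (sumL-linear states) (λ t → ind (blockOK t) * G (blockCorners t))) ⟩
    cube (sumL states) (λ u → weight³ v u * (ind (blockOK (map3 cd u)) * G (blockCorners (map3 cd u))))
      ≈⟨ sym (sumL-triples states (λ u → weight³ v u * (ind (blockOK (map3 cd u)) * G (blockCorners (map3 cd u))))) ⟩
    sumL triples
         (λ u → weight³ v u * (ind (blockOK (map3 cd u)) * G (blockCorners (map3 cd u))))
      ≈⟨ cong (sumL-linear triples) (λ u → x*[i*y]≈[x*y]*i (weight³ v u) (ind (blockOK (map3 cd u))) (G (blockCorners (map3 cd u)))) ⟩
    sumL triples
         (λ u → (weight³ v u * G (blockCorners (map3 cd u))) * ind (blockOK (map3 cd u)))
      ≈⟨ sym (sumL-filter (λ u → blockOK (map3 cd u)) triples _) ⟩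
    sumL (filter (λ u → blockOK (map3 cd u) B.≟ true) triples)
         (λ u → weight³ v u * G (blockCorners (map3 cd u)))
      ≈⟨ surviving parity ⟩
    stateOp (not parity) (blockWeights v) G ∎
    where
    cd = cornerDegrees parity
    triples = cartesianProduct states (cartesianProduct states states)
    x*[i*y]≈[x*y]*i : ∀ x i y → x * (i * y) ≈ (x * y) * i
    x*[i*y]≈[x*y]*i x i y = trans (*-congˡ (*-comm i y)) (sym (*-assoc x y i))
    regroup : ∀ a b c d e f g h G0 G1 G2 G3 →
      a * G2 + (b * G1 + (c * G0 + (d * G3 + (e * G0 + (f * G3 + (g * G2 + (h * G1 + 0#))))))) ≈
      (c + e) * G0 + ((b + h) * G1 + ((a + g) * G2 + ((d + f) * G3 + 0#)))
    regroup = Solver.solve 12 (λ a b c d e f g h G0 G1 G2 G3 →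
      a :* G2 :+ (b :* G1 :+ (c :* G0 :+ (d :* G3 :+ (e :* G0 :+ (f :* G3 :+ (g :* G2 :+ (h :* G1 :+ con 0))))))) :=
      (c :+ e) :* G0 :+ ((b :+ h) :* G1 :+ ((a :+ g) :* G2 :+ ((d :+ f) :* G3 :+ con 0)))) ≈-refl
    surviving : ∀ parity → sumL (filter (λ u → blockOK (map3 (cornerDegrees parity) u) B.≟ true) triples)
                                (λ u → weight³ v u * G (blockCorners (map3 (cornerDegrees parity) u)))
                           ≈ stateOp (not parity) (blockWeights v) G
    surviving true = regroup _ _ _ _ _ _ _ _ _ _ _ _
    surviving false = regroup _ _ _ _ _ _ _ _ _ _ _ _

-- Γ_(m+1) has parity true exactly when m is even.
parityOf : ℕ → Bool
parityOf m = isOdd (suc m)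

cornerRule : Bool → ℕ → Bool
cornerRule parity n = if parity then ((n ≡ᵇ 0) ∨ (n ≡ᵇ 2)) else ((n ≡ᵇ 1) ∨ (n ≡ᵇ 3))

nextExponent : Bool → ℕ → ℕ
nextExponent true e = e N.+ (e N.+ e)
nextExponent false e = suc (suc (e N.+ (e N.+ e)))

exponentOf : ℕ → ℕ
exponentOf zero = 0
exponentOf (suc m) = nextExponent (parityOf m) (exponentOf m)

-- 4 · exponentOf m + remainder = 3^m, with remainder 1 at parity true and 3
-- at parity false.
remainder : Bool → ℕ
remainder true = 1
remainder false = 3

nextExponent-spec : ∀ parity e → nextExponent parity e N.* 4 N.+ remainder (not parity) ≡ 3 N.* (e N.* 4 N.+ remainder parity)
nextExponent-spec true = solve 1 (λ e → (e :+ (e :+ e)) :* con 4 :+ con 3 := con 3 :* (e :* con 4 :+ con 1)) refl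
  where open +-*-Solver
nextExponent-spec false = solve 1 (λ e → (con 2 :+ (e :+ (e :+ e))) :* con 4 :+ con 1 := con 3 :* (e :* con 4 :+ con 3)) refl
  where open +-*-Solver

exponentOf-spec : ∀ m → exponentOf m N.* 4 N.+ remainder (parityOf m) ≡ 3 ^ m
exponentOf-spec zero = refl
exponentOf-spec (suc m) = P.trans (nextExponent-spec (parityOf m) (exponentOf m)) (P.cong (3 N.*_) (exponentOf-spec m))

exponentOf-formula : ∀ m → (3 ^ m ∸ remainder (parityOf m)) / 4 ≡ exponentOf m
exponentOf-formula m = begin
  (3 ^ m ∸ r) / 4                          ≡⟨ P.cong (λ n → (n ∸ r) / 4) (P.sym (exponentOf-spec m)) ⟩
  (exponentOf m N.* 4 N.+ r ∸ r) / 4       ≡⟨ P.cong (_/ 4) (ℕP.m+n∸n≡m (exponentOf m N.* 4) r) ⟩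
  exponentOf m N.* 4 / 4                   ≡⟨ m*n/n≡m (exponentOf m) 4 ⟩
  exponentOf m                             ∎
  where
  open P.≡-Reasoning
  r = remainder (parityOf m)

isOdd-% : ∀ n → n % 2 ≡ (if isOdd n then 1 else 0)
isOdd-% zero = refl
isOdd-% (suc zero) = refl
isOdd-% (suc (suc n)) = begin
  suc (suc n) % 2                ≡⟨ P.cong (_% 2) (ℕP.+-comm 2 n) ⟩
  (n N.+ 2) % 2                  ≡⟨ [m+n]%n≡m%n n 2 ⟩
  n % 2                          ≡⟨ isOdd-% n ⟩
  (if isOdd n then 1 else 0)     ≡⟨ P.cong (λ p → if p then 1 else 0) (P.sym (not-involutive (isOdd n))) ⟩
  (if not (not (isOdd n)) then 1 else 0) ∎
  where open P.≡-Reasoning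

module ClosedForm {ℓ₁ ℓ₂ : Level} (R : CommutativeSemiring ℓ₁ ℓ₂) (a b c : CommutativeSemiring.Carrier R) where
  open CommutativeSemiring R hiding (zero) renaming (refl to ≈-refl)
  open Summation R
  open Renormalization R
  open States R
  open import Relation.Binary.Reasoning.Setoid setoid
  import Algebra.Solver.Ring.NaturalCoefficients.Default R as Solver
  open Solver using (_:+_; _:*_; _:=_; con)

  X : Carrier
  X = (1# + 1#) * (1# + 1#) * a * b * c

  stateWeights : Bool → Carrier → State → Carrier
  stateWeights true μ s0 = μ
  stateWeights true μ s1 = μ * a
  stateWeights true μ s2 = μ * b
  stateWeights true μ s3 = μ * c
  stateWeights false μ s0 = (1# + 1#) * μ * (a * b)
  stateWeights false μ s1 = (1# + 1#) * μ * (a * c)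
  stateWeights false μ s2 = (1# + 1#) * μ * (b * c)
  stateWeights false μ s3 = (1# + 1#) * μ * (a * b * c)

  stateWeights-resp : ∀ parity {μ ν} → μ ≈ ν → ∀ s → stateWeights parity μ s ≈ stateWeights parity ν s
  stateWeights-resp true e s0 = e
  stateWeights-resp true e s1 = *-congʳ e
  stateWeights-resp true e s2 = *-congʳ e
  stateWeights-resp true e s3 = *-congʳ e
  stateWeights-resp false e s0 = *-congʳ (*-congˡ e)
  stateWeights-resp false e s1 = *-congʳ (*-congˡ e)
  stateWeights-resp false e s2 = *-congʳ (*-congˡ e)
  stateWeights-resp false e s3 = *-congʳ (*-congˡ e)

  blockWeights-even : ∀ μ s → blockWeights (stateWeights true μ) s ≈ stateWeights false (μ * (μ * μ)) s
  blockWeights-even μ s0 = Solver.solve 4 (λ m a b c → (m :* a) :* ((m :* b) :* m) :+ (m :* b) :* (m :* (m :* a)) :=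
    (con 1 :+ con 1) :* (m :* (m :* m)) :* (a :* b)) ≈-refl μ a b c
  blockWeights-even μ s1 = Solver.solve 4 (λ m a b c → m :* ((m :* c) :* (m :* a)) :+ (m :* c) :* ((m :* a) :* m) :=
    (con 1 :+ con 1) :* (m :* (m :* m)) :* (a :* c)) ≈-refl μ a b c
  blockWeights-even μ s2 = Solver.solve 4 (λ m a b c → m :* ((m :* b) :* (m :* c)) :+ (m :* c) :* (m :* (m :* b)) :=
    (con 1 :+ con 1) :* (m :* (m :* m)) :* (b :* c)) ≈-refl μ a b c
  blockWeights-even μ s3 = Solver.solve 4 (λ m a b c → (m :* a) :* ((m :* c) :* (m :* b)) :+ (m :* b) :* ((m :* a) :* (m :* c)) :=
    (con 1 :+ con 1) :* (m :* (m :* m)) :* (a :* b :* c)) ≈-refl μ a b c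

  blockWeights-odd : ∀ μ s → blockWeights (stateWeights false μ) s ≈ stateWeights true (X * (X * (μ * (μ * μ)))) s
  blockWeights-odd μ s0 = Solver.solve 4 (λ m a b c →
      (two :* m :* (a :* c)) :* ((two :* m :* (b :* c)) :* (two :* m :* (a :* b)))
    :+ (two :* m :* (b :* c)) :* ((two :* m :* (a :* b)) :* (two :* m :* (a :* c))) :=
      (two :* two :* a :* b :* c) :* ((two :* two :* a :* b :* c) :* (m :* (m :* m)))) ≈-refl μ a b c
    where two = con 1 :+ con 1
  blockWeights-odd μ s1 = Solver.solve 4 (λ m a b c →
      (two :* m :* (a :* b)) :* ((two :* m :* (a :* b :* c)) :* (two :* m :* (a :* c)))
    :+ (two :* m :* (a :* b :* c)) :* ((two :* m :* (a :* c)) :* (two :* m :* (a :* b))) :=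
      (two :* two :* a :* b :* c) :* ((two :* two :* a :* b :* c) :* (m :* (m :* m))) :* a) ≈-refl μ a b c
    where two = con 1 :+ con 1
  blockWeights-odd μ s2 = Solver.solve 4 (λ m a b c →
      (two :* m :* (a :* b)) :* ((two :* m :* (b :* c)) :* (two :* m :* (a :* b :* c)))
    :+ (two :* m :* (a :* b :* c)) :* ((two :* m :* (a :* b)) :* (two :* m :* (b :* c))) :=
      (two :* two :* a :* b :* c) :* ((two :* two :* a :* b :* c) :* (m :* (m :* m))) :* b) ≈-refl μ a b c
    where two = con 1 :+ con 1
  blockWeights-odd μ s3 = Solver.solve 4 (λ m a b c →
      (two :* m :* (a :* c)) :* ((two :* m :* (a :* b :* c)) :* (two :* m :* (b :* c)))
    :+ (two :* m :* (b :* c)) :* ((two :* m :* (a :* c)) :* (two :* m :* (a :* b :* c))) :=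
      (two :* two :* a :* b :* c) :* ((two :* two :* a :* b :* c) :* (m :* (m :* m))) :* c) ≈-refl μ a b c
    where two = con 1 :+ con 1

  pow-+ : ∀ x m n → pow R x (m N.+ n) ≈ pow R x m * pow R x n
  pow-+ x zero n = sym (*-identityˡ _)
  pow-+ x (suc m) n = trans (*-congˡ (pow-+ x m n)) (sym (*-assoc _ _ _))

  pow-triple : ∀ x e → pow R x (e N.+ (e N.+ e)) ≈ pow R x e * (pow R x e * pow R x e)
  pow-triple x e = trans (pow-+ x e (e N.+ e)) (*-congˡ (pow-+ x e e))

  blockWeights-pow : ∀ parity e s →
    blockWeights (stateWeights parity (pow R X e)) s ≈ stateWeights (not parity) (pow R X (nextExponent parity e)) s
  blockWeights-pow true e s =
    trans (blockWeights-even (pow R X e) s) (stateWeights-resp false (sym (pow-triple X e)) s)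
  blockWeights-pow false e s =
    trans (blockWeights-odd (pow R X e) s) (stateWeights-resp true (*-congˡ (*-congˡ (sym (pow-triple X e)))) s)

  levelWeights : ℕ → State → Carrier
  levelWeights i = stateWeights (parityOf i) (pow R X (exponentOf i))

  levelOp : ℕ → Op Degrees
  levelOp i = stateOp (parityOf i) (levelWeights i)

  levelOp-step : ∀ i → coarsen (levelOp i) ≋ levelOp (suc i)
  levelOp-step i G = trans (coarsen-stateOp (parityOf i) (levelWeights i) G)
    (stateOp-resp (not (parityOf i)) (blockWeights-pow (parityOf i) (exponentOf i)) G)

  closedForm : Bool → Carrier → Carrier
  closedForm true μ = μ * (1# + a + b + c)
  closedForm false μ = (1# + 1#) * μ * (a * b * c + a * b + a * c + b * c)

  -- All four states of a single triangle are dimer coverings.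
  Z-base : ∀ parity μ → Z 0 (stateOp parity (stateWeights parity μ)) (cornerRule parity) ≈ closedForm parity μ
  Z-base true μ = Solver.solve 4 (λ m a b c →
    m :* con 1 :+ (m :* a :* con 1 :+ (m :* b :* con 1 :+ (m :* c :* con 1 :+ con 0))) :=
    m :* (con 1 :+ a :+ b :+ c)) ≈-refl μ a b c
  Z-base false μ = Solver.solve 4 (λ m a b c →
      two :* m :* (a :* b) :* con 1 :+ (two :* m :* (a :* c) :* con 1 :+
        (two :* m :* (b :* c) :* con 1 :+ (two :* m :* (a :* b :* c) :* con 1 :+ con 0))) :=
      two :* m :* (a :* b :* c :+ a :* b :+ a :* c :+ b :* c)) ≈-refl μ a b c
    where two = con 1 :+ con 1

  Z-closedForm : ∀ m → Z m (levelOp 0) (cornerRule (parityOf m)) ≈ closedForm (parityOf m) (pow R X (exponentOf m))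
  Z-closedForm m = trans
    (renormalize-iterate m levelOp (λ i → stateOp-linear (parityOf i) (levelWeights i))
                         (λ i → stateOp-fubini (parityOf i) (levelWeights i)) levelOp-step (cornerRule (parityOf m)))
    (Z-base (parityOf m) (pow R X (exponentOf m)))

-- An edge set of Γ_(m+1) is a set of triangle edges; we organise it as a
-- tree of subsets of {a, b, c}, the leaf at w listing the chosen edges of the
-- triangle at w.  pre is the address of the subtree.
flatten : ∀ k {m} → (Word k → Word m) → Tree k (List L) → List (TriEdge m)
flatten zero pre d = map (pre [] ,_) d
flatten (suc k) pre t =
  flatten k (λ w → pre (l0 ∷ w)) (pick l0 t) ++ (flatten k (λ w → pre (l1 ∷ w)) (pick l1 t) ++ flatten k (λ w → pre (l2 ∷ w)) (pick l2 t))

allEdgesTree : ∀ {k} → Tree k (List L)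
allEdgesTree {zero} = allLetters
allEdgesTree {suc k} = allEdgesTree , allEdgesTree , allEdgesTree

flatten-allEdges : ∀ k {m} (pre : Word k → Word m) →
  concatMap (λ w → map (pre w ,_) allLetters) (allWords k) ≡ flatten k pre allEdgesTree
flatten-allEdges zero pre = ++-identityʳ _
flatten-allEdges (suc k) pre = begin
  concatMap f (map (l0 ∷_) A ++ (map (l1 ∷_) A ++ (map (l2 ∷_) A ++ [])))
    ≡⟨ concatMap-++ f (map (l0 ∷_) A) _ ⟩
  concatMap f (map (l0 ∷_) A) ++ concatMap f (map (l1 ∷_) A ++ (map (l2 ∷_) A ++ []))
    ≡⟨ P.cong (concatMap f (map (l0 ∷_) A) ++_) (concatMap-++ f (map (l1 ∷_) A) _) ⟩
  concatMap f (map (l0 ∷_) A) ++ (concatMap f (map (l1 ∷_) A) ++ concatMap f (map (l2 ∷_) A ++ []))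
    ≡⟨ P.cong₂ (λ u v → u ++ (concatMap f (map (l1 ∷_) A) ++ v)) (block l0)
                (P.trans (P.cong (concatMap f) (++-identityʳ (map (l2 ∷_) A))) (block l2)) ⟩
  flatten k _ allEdgesTree ++ (concatMap f (map (l1 ∷_) A) ++ flatten k _ allEdgesTree)
    ≡⟨ P.cong (λ v → flatten k _ allEdgesTree ++ (v ++ flatten k _ allEdgesTree)) (block l1) ⟩
  flatten (suc k) pre allEdgesTree ∎
  where
  open P.≡-Reasoning
  A = allWords k
  f = λ w → map (pre w ,_) allLetters
  block : ∀ x → concatMap f (map (x ∷_) A) ≡ flatten k (λ w → pre (x ∷ w)) allEdgesTree
  block x = P.trans (concatMap-map f (x ∷_) A) (flatten-allEdges k (λ w → pre (x ∷ w)))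

allTriEdges-flatten : ∀ m → allTriEdges m ≡ flatten m (λ w → w) allEdgesTree
allTriEdges-flatten m = flatten-allEdges m (λ w → w)

count : L → List L → ℕ
count x d = deg {0} (map ([] ,_) d) (x ∷ [])

subsetDegrees : List L → Degrees
subsetDegrees d = count l0 d , count l1 d , count l2 d

pick-subsetDegrees : ∀ x d → pick x (subsetDegrees d) ≡ count x d
pick-subsetDegrees zero d = refl
pick-subsetDegrees (suc zero) d = refl
pick-subsetDegrees (suc (suc zero)) d = refl

==W-refl : ∀ {n} (w : Word n) → (w ==W w) ≡ true
==W-refl [] = refl
==W-refl (zero ∷ w) = ==W-refl w
==W-refl (suc zero ∷ w) = ==W-refl w
==W-refl (suc (suc zero) ∷ w) = ==W-refl w

deg-++ : ∀ {m} (E E′ : List (TriEdge m)) u → deg (E ++ E′) u ≡ deg E u N.+ deg E′ u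
deg-++ [] E′ u = refl
deg-++ (e ∷ E) E′ u with incident u e
... | true = P.cong suc (deg-++ E E′ u)
... | false = deg-++ E E′ u

∧-factorʳ : ∀ p q v → ((p ∧ v) ∨ (q ∧ v)) ≡ (v ∧ ((p ∧ true) ∨ (q ∧ true)))
∧-factorʳ p q true = refl
∧-factorʳ true true false = refl
∧-factorʳ true false false = refl
∧-factorʳ false true false = refl
∧-factorʳ false false false = refl

incident-∷ : ∀ {m} (x : L) (w w′ : Word m) (s : L) → incident (x ∷ w) (w′ , s) ≡ ((w ==W w′) ∧ incident {0} (x ∷ []) ([] , s))
incident-∷ x w w′ zero = ∧-factorʳ (x ==L l0) (x ==L l1) (w ==W w′)
incident-∷ x w w′ (suc zero) = ∧-factorʳ (x ==L l0) (x ==L l2) (w ==W w′)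
incident-∷ x w w′ (suc (suc zero)) = ∧-factorʳ (x ==L l1) (x ==L l2) (w ==W w′)

deg-map : ∀ {m} (x : L) (w w′ : Word m) (d : List L) → deg (map (w′ ,_) d) (x ∷ w) ≡ (if w ==W w′ then count x d else 0)
deg-map x w w′ [] with w ==W w′
... | true = refl
... | false = refl
deg-map x w w′ (s ∷ d) rewrite incident-∷ x w w′ s with w ==W w′ | deg-map x w w′ d
... | false | ih = ih
... | true | ih with incident {0} (x ∷ []) ([] , s)
...   | true = P.cong suc ih
...   | false = ih

sumW : ∀ k → (Word k → ℕ) → ℕ
sumW zero f = f []
sumW (suc k) f = sumW k (λ v → f (l0 ∷ v)) N.+ (sumW k (λ v → f (l1 ∷ v)) N.+ sumW k (λ v → f (l2 ∷ v)))

sumW-0 : ∀ k → sumW k (λ _ → 0) ≡ 0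
sumW-0 zero = refl
sumW-0 (suc k) rewrite sumW-0 k = refl

sumW-δ : ∀ k (w : Word k) (f : Word k → ℕ) → sumW k (λ v → if w ==W v then f v else 0) ≡ f w
sumW-δ zero [] f = refl
sumW-δ (suc k) (zero ∷ w) f rewrite sumW-δ k w (λ v → f (l0 ∷ v)) | sumW-0 k = ℕP.+-identityʳ _
sumW-δ (suc k) (suc zero ∷ w) f rewrite sumW-δ k w (λ v → f (l1 ∷ v)) | sumW-0 k = ℕP.+-identityʳ _
sumW-δ (suc k) (suc (suc zero) ∷ w) f rewrite sumW-δ k w (λ v → f (l2 ∷ v)) | sumW-0 k = refl

deg-flatten : ∀ k {m} (pre : Word k → Word m) (t : Tree k (List L)) (x : L) (w : Word m) →
  deg (flatten k pre t) (x ∷ w) ≡ sumW k (λ v → if w ==W pre v then count x (at t v) else 0)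
deg-flatten zero pre t x w = deg-map x w (pre []) t
deg-flatten (suc k) pre t x w =
  P.trans (deg-++ (flatten k _ (pick l0 t)) _ (x ∷ w)) (P.cong₂ N._+_ (deg-flatten k _ (pick l0 t) x w)
    (P.trans (deg-++ (flatten k _ (pick l1 t)) _ (x ∷ w)) (P.cong₂ N._+_ (deg-flatten k _ (pick l1 t) x w) (deg-flatten k _ (pick l2 t) x w))))

-- The two triangle edges at u are filtered out by `partners`; the third
-- generator moves u to its partner unless it fixes u.
partners-∷ : ∀ {m} (u : Word (suc m)) → partners u ≡ partnersOf u
partners-∷ (zero ∷ w) with w ==W w | ==W-refl w
... | .true | refl with w ==W w | ==W-refl w
... | .true | refl with act l2 w ==W w | w ==W act l2 w
... | true | b = refl
... | false | b rewrite ∧-zeroʳ b = refl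
partners-∷ (suc zero ∷ w) with w ==W w | ==W-refl w
... | .true | refl with act l1 w ==W w | w ==W act l1 w
... | true | b with w ==W w | ==W-refl w
... | .true | refl = refl
partners-∷ (suc zero ∷ w) | .true | refl | false | b rewrite ∧-zeroʳ b with w ==W w | ==W-refl w
... | .true | refl = refl
partners-∷ (suc (suc zero) ∷ w) with act l0 w ==W w | w ==W act l0 w
... | true | b with w ==W w | ==W-refl w
... | .true | refl with w ==W w | ==W-refl w
... | .true | refl = refl
partners-∷ (suc (suc zero) ∷ w) | false | b rewrite ∧-zeroʳ b with w ==W w | ==W-refl w
... | .true | refl with w ==W w | ==W-refl w
... | .true | refl = refl

countOnes-map : {A : Set} (f : A → ℕ) (xs : List A) → length (filter (λ u → (1 ≡ᵇ f u) B.≟ true) xs) ≡ countOnes (map f xs)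
countOnes-map f [] = refl
countOnes-map f (x ∷ xs) with 1 ≡ᵇ f x
... | true = P.cong suc (countOnes-map f xs)
... | false = countOnes-map f xs

-- Two edges of a triangle (possibly the same one) share a vertex.
sharedVertex : L → L → L
sharedVertex zero zero = l0
sharedVertex zero (suc zero) = l0
sharedVertex zero (suc (suc zero)) = l1
sharedVertex (suc zero) zero = l0
sharedVertex (suc zero) (suc zero) = l0
sharedVertex (suc zero) (suc (suc zero)) = l2
sharedVertex (suc (suc zero)) zero = l1
sharedVertex (suc (suc zero)) (suc zero) = l2
sharedVertex (suc (suc zero)) (suc (suc zero)) = l1

twoEdgesMeet : ∀ s t d → leq1 (count (sharedVertex s t) (s ∷ t ∷ d)) ≡ false
twoEdgesMeet zero zero d = refl
twoEdgesMeet zero (suc zero) d = refl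
twoEdgesMeet zero (suc (suc zero)) d = refl
twoEdgesMeet (suc zero) zero d = refl
twoEdgesMeet (suc zero) (suc zero) d = refl
twoEdgesMeet (suc zero) (suc (suc zero)) d = refl
twoEdgesMeet (suc (suc zero)) zero d = refl
twoEdgesMeet (suc (suc zero)) (suc zero) d = refl
twoEdgesMeet (suc (suc zero)) (suc (suc zero)) d = refl

atMostOneEdge : ∀ d → (∀ x → leq1 (count x d) ≡ true) → leq1 (length d) ≡ true
atMostOneEdge [] h = refl
atMostOneEdge (s ∷ []) h = refl
atMostOneEdge (s ∷ t ∷ d) h with P.trans (P.sym (h (sharedVertex s t))) (twoEdgesMeet s t d)
... | ()

leq1-+ : ∀ a b → leq1 (a N.+ b) ≡ true → leq1 a ≡ true
leq1-+ zero b e = refl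
leq1-+ (suc zero) b e = refl

module FromEdgeSet (m : ℕ) (χ : Tree m (List L)) where

  edges : List (TriEdge m)
  edges = flatten m (λ w → w) χ

  config : Config m
  config = mapT subsetDegrees χ

  degree-config : ∀ u → deg edges u ≡ degreeIn config u
  degree-config (x ∷ w) = begin
    deg edges (x ∷ w)                       ≡⟨ deg-flatten m (λ w → w) χ x w ⟩
    sumW m (λ v → if w ==W v then count x (at χ v) else 0) ≡⟨ sumW-δ m w (λ v → count x (at χ v)) ⟩
    count x (at χ w)                        ≡⟨ P.sym (pick-subsetDegrees x (at χ w)) ⟩
    pick x (subsetDegrees (at χ w))         ≡⟨ P.cong (pick x) (P.sym (at-mapT subsetDegrees χ w)) ⟩
    degreeIn config (x ∷ w)                 ∎
    where open P.≡-Reasoning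

  classDegree-config : ∀ u → classDeg edges u ≡ classDegreeIn config u
  classDegree-config u = P.cong₂ N._+_ (degree-config u)
    (P.trans (P.cong (λ ps → foldr N._+_ 0 (map (deg edges) ps)) (partners-∷ u))
             (P.cong (foldr N._+_ 0) (map-cong degree-config (partnersOf u))))

  cornersCovered-config : coveredCorners edges ≡ cornersCovered config
  cornersCovered-config = P.trans (countOnes-map (deg edges) (corners (suc m)))
    (P.cong countOnes (map-cong degree-config (corners (suc m))))

  isDimer-config : isDimer edges ≡ isCovering m (cornerRule (parityOf m)) config
  isDimer-config = begin
    allB c₁ W ∧ (allB c₂ W ∧ cornerRule (parityOf m) (coveredCorners edges))
      ≡⟨ P.sym (∧-assoc (allB c₁ W) _ _) ⟩
    (allB c₁ W ∧ allB c₂ W) ∧ cornerRule (parityOf m) (coveredCorners edges)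
      ≡⟨ P.cong₂ _∧_ (P.sym (allB-∧ c₁ c₂ W)) (P.cong (cornerRule (parityOf m)) cornersCovered-config) ⟩
    allB (λ u → c₁ u ∧ c₂ u) W ∧ cornerRule (parityOf m) (cornersCovered config)
      ≡⟨ P.cong (_∧ cornerRule (parityOf m) (cornersCovered config)) (allB-cong W (λ u → P.cong (vertexCondition (isCorner u)) (classDegree-config u))) ⟩
    isCovering m (cornerRule (parityOf m)) config ∎
    where
    open P.≡-Reasoning
    W = allWords (suc m)
    c₁ c₂ : Word (suc m) → Bool
    c₁ u = leq1 (classDeg edges u)
    c₂ u = isCorner u ∨ (1 ≡ᵇ classDeg edges u)

  fewEdges : ∀ Q → isCovering m Q config ≡ true → ∀ w → leq1 (length (at χ w)) ≡ true
  fewEdges Q e w = atMostOneEdge (at χ w) (λ x → P.subst (λ n → leq1 n ≡ true) (degree x)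
    (leq1-+ (degreeIn config (x ∷ w)) _ (∧-conicalˡ _ _ (allWords-sound (suc m) (vertexOK config) (∧-conicalˡ _ _ e) (x ∷ w)))))
    where
    degree : ∀ x → degreeIn config (x ∷ w) ≡ count x (at χ w)
    degree x = P.trans (P.cong (pick x) (at-mapT subsetDegrees χ w)) (pick-subsetDegrees x (at χ w))

module DimerSum {ℓ₁ ℓ₂ : Level} (R : CommutativeSemiring ℓ₁ ℓ₂) (a b c : CommutativeSemiring.Carrier R) where
  open CommutativeSemiring R hiding (zero) renaming (refl to ≈-refl)
  open Summation R
  open Renormalization R
  open States R
  open ClosedForm R a b c
  open import Relation.Binary.Reasoning.Setoid setoid
  import Algebra.Solver.Ring.NaturalCoefficients.Default R as Solver
  open Solver using (_:+_; _:*_; _:=_; con)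

  edgeWeight : ∀ {m} → List (TriEdge m) → Carrier
  edgeWeight D = foldr _*_ 1# (map (λ e → weight R a b c (proj₂ e)) D)

  edgeWeight-++ : ∀ {m} (D E : List (TriEdge m)) → edgeWeight (D ++ E) ≈ edgeWeight D * edgeWeight E
  edgeWeight-++ [] E = sym (*-identityˡ _)
  edgeWeight-++ (e ∷ D) E = trans (*-congˡ (edgeWeight-++ D E)) (sym (*-assoc _ _ _))

  labelWeight : List L → Carrier
  labelWeight d = foldr _*_ 1# (map (weight R a b c) d)

  edgeWeight-map : ∀ {m} (w : Word m) (d : List L) → edgeWeight (map (w ,_) d) ≡ labelWeight d
  edgeWeight-map w [] = refl
  edgeWeight-map w (s ∷ d) = P.cong (weight R a b c s *_) (edgeWeight-map w d)

  edgeWeight-flatten : ∀ k {m} (pre : Word k → Word m) (t : Tree k (List L)) → edgeWeight (flatten k pre t) ≈ prodT labelWeight t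
  edgeWeight-flatten zero pre t = reflexive (edgeWeight-map (pre []) t)
  edgeWeight-flatten (suc k) pre t =
    trans (edgeWeight-++ (flatten k _ (pick l0 t)) _) (*-cong (edgeWeight-flatten k _ (pick l0 t))
      (trans (edgeWeight-++ (flatten k _ (pick l1 t)) _) (*-cong (edgeWeight-flatten k _ (pick l1 t)) (edgeWeight-flatten k _ (pick l2 t)))))

  prodT-cong : ∀ k {X : Set} {ω ω′ : X → Carrier} (t : Tree k X) → (∀ w → ω (at t w) ≈ ω′ (at t w)) → prodT ω t ≈ prodT ω′ t
  prodT-cong zero t e = e []
  prodT-cong (suc k) t e = *-cong (prodT-cong k (pick l0 t) (λ w → e (l0 ∷ w)))
    (*-cong (prodT-cong k (pick l1 t) (λ w → e (l1 ∷ w))) (prodT-cong k (pick l2 t) (λ w → e (l2 ∷ w))))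

  sumL-sublists-++ : {A : Set} (xs ys : List A) (G : List A → Carrier) →
    sumL (sublists (xs ++ ys)) G ≈ (sumL (sublists xs) ⊗ sumL (sublists ys)) (λ p → G (proj₁ p ++ proj₂ p))
  sumL-sublists-++ [] ys G = sym (+-identityʳ _)
  sumL-sublists-++ (x ∷ xs) ys G = begin
    sumL (r ++ map (x ∷_) r) G                    ≈⟨ sumL-++ r _ G ⟩
    sumL r G + sumL (map (x ∷_) r) G              ≈⟨ +-congˡ (reflexive (sumL-map (x ∷_) r G)) ⟩
    sumL r G + sumL r (λ D → G (x ∷ D))           ≈⟨ +-cong (sumL-sublists-++ xs ys G) (sumL-sublists-++ xs ys (λ D → G (x ∷ D))) ⟩
    sumL r′ H + sumL r′ (λ D → H (x ∷ D))         ≈⟨ +-congˡ (reflexive (P.sym (sumL-map (x ∷_) r′ H))) ⟩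
    sumL r′ H + sumL (map (x ∷_) r′) H            ≈⟨ sym (sumL-++ r′ _ H) ⟩
    sumL (r′ ++ map (x ∷_) r′) H                  ∎
    where
    r = sublists (xs ++ ys)
    r′ = sublists xs
    H = λ D → sumL (sublists ys) (λ E → G (D ++ E))

  sumL-sublists-flatten : ∀ k {m} (pre : Word k → Word m) (G : List (TriEdge m) → Carrier) →
    sumL (sublists (flatten k pre allEdgesTree)) G ≈ treeSum k (sumL (sublists allLetters)) (λ t → G (flatten k pre t))
  sumL-sublists-flatten zero pre G = ≈-refl
  sumL-sublists-flatten (suc k) pre G = begin
    sumL (sublists (F l0 ++ (F l1 ++ F l2))) G
      ≈⟨ sumL-sublists-++ (F l0) _ G ⟩
    sumL (sublists (F l0)) (λ D0 → sumL (sublists (F l1 ++ F l2)) (λ D → G (D0 ++ D)))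
      ≈⟨ C (λ D0 → sumL-sublists-++ (F l1) (F l2) _) ⟩
    sumL (sublists (F l0)) (λ D0 → sumL (sublists (F l1)) (λ D1 → sumL (sublists (F l2)) (λ D2 → G (D0 ++ (D1 ++ D2)))))
      ≈⟨ C (λ D0 → cong (sumL-linear (sublists (F l1))) (λ D1 → IH l2 (λ D2 → G (D0 ++ (D1 ++ D2))))) ⟩
    sumL (sublists (F l0)) (λ D0 → sumL (sublists (F l1)) (λ D1 → T (λ t2 → G (D0 ++ (D1 ++ flat l2 t2)))))
      ≈⟨ C (λ D0 → IH l1 (λ D1 → T (λ t2 → G (D0 ++ (D1 ++ flat l2 t2))))) ⟩
    sumL (sublists (F l0)) (λ D0 → T (λ t1 → T (λ t2 → G (D0 ++ (flat l1 t1 ++ flat l2 t2)))))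
      ≈⟨ IH l0 (λ D0 → T (λ t1 → T (λ t2 → G (D0 ++ (flat l1 t1 ++ flat l2 t2))))) ⟩
    treeSum (suc k) (sumL (sublists allLetters)) (λ t → G (flatten (suc k) pre t)) ∎
    where
    flat : L → Tree k (List L) → List (TriEdge _)
    flat x = flatten k (λ w → pre (x ∷ w))
    F : L → List (TriEdge _)
    F x = flat x allEdgesTree
    T = treeSum k (sumL (sublists allLetters))
    IH : ∀ x G → sumL (sublists (F x)) G ≈ T (λ t → G (flat x t))
    IH x = sumL-sublists-flatten k (λ w → pre (x ∷ w))
    C = cong (sumL-linear (sublists (F l0)))

  foldr-sumL : {A : Set} (g : A → Carrier) (xs : List A) → foldr _+_ 0# (map g xs) ≡ sumL xs g
  foldr-sumL g [] = refl
  foldr-sumL g (x ∷ xs) = P.cong (g x +_) (foldr-sumL g xs)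

  -- A triangle contributes to a covering only if it carries at most one edge.
  singleWeight : List L → Carrier
  singleWeight d = if leq1 (length d) then labelWeight d else 0#

  -- The subsets of a triangle with at most one edge are its four states at
  -- parity true, with weights 1, a, b, c.
  triangleOp : push (sumL (sublists allLetters)) singleWeight subsetDegrees ≋ levelOp 0
  triangleOp G = Solver.solve 11 (λ a b c g0 g1 g2 g3 j1 j2 j3 j4 →
      con 1 :* g0 :+ ((c :* con 1) :* g3 :+ ((b :* con 1) :* g2 :+ (con 0 :* j1 :+ ((a :* con 1) :* g1 :+
        (con 0 :* j2 :+ (con 0 :* j3 :+ (con 0 :* j4 :+ con 0))))))) :=
      con 1 :* g0 :+ ((con 1 :* a) :* g1 :+ ((con 1 :* b) :* g2 :+ ((con 1 :* c) :* g3 :+ con 0)))) ≈-refl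
    a b c (G (0 , 0 , 0)) (G (1 , 1 , 0)) (G (1 , 0 , 1)) (G (0 , 1 , 1)) (G (1 , 1 , 2)) (G (1 , 2 , 1)) (G (2 , 1 , 1)) (G (2 , 2 , 2))

  Φ-as-Z : ∀ m → Φ R m a b c ≈ Z m (levelOp 0) (cornerRule (parityOf m))
  Φ-as-Z m = begin
    Φ R m a b c
      ≡⟨ foldr-sumL edgeWeight (dimerCoverings m) ⟩
    sumL (dimerCoverings m) edgeWeight
      ≈⟨ sumL-filter isDimer (sublists (allTriEdges m)) edgeWeight ⟩
    sumL (sublists (allTriEdges m)) (λ D → edgeWeight D * ind (isDimer D))
      ≡⟨ P.cong (λ T → sumL (sublists T) (λ D → edgeWeight D * ind (isDimer D))) (allTriEdges-flatten m) ⟩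
    sumL (sublists (flatten m (λ w → w) allEdgesTree)) (λ D → edgeWeight D * ind (isDimer D))
      ≈⟨ sumL-sublists-flatten m (λ w → w) _ ⟩
    treeSum m (sumL subsets) (λ χ → edgeWeight (FromEdgeSet.edges m χ) * ind (isDimer (FromEdgeSet.edges m χ)))
      ≈⟨ cong (treeSum-linear m (sumL-linear subsets)) local ⟩
    push (treeSum m (sumL subsets)) (prodT singleWeight) (mapT subsetDegrees) (λ η → ind (isCovering m Q η))
      ≈⟨ treeSum-push m singleWeight subsetDegrees (sumL-linear subsets) _ ⟩
    Z m (push (sumL subsets) singleWeight subsetDegrees) Q
      ≈⟨ Z-resp m (push-linear singleWeight subsetDegrees (sumL-linear subsets)) triangleOp Q ⟩
    Z m (levelOp 0) Q ∎
    where
    subsets = sublists allLetters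
    Q = cornerRule (parityOf m)
    local : ∀ χ → edgeWeight (FromEdgeSet.edges m χ) * ind (isDimer (FromEdgeSet.edges m χ))
                  ≈ prodT singleWeight χ * ind (isCovering m Q (mapT subsetDegrees χ))
    local χ with isCovering m Q (mapT subsetDegrees χ) in covering
    ... | false = trans (*-congˡ (reflexive (P.cong ind (P.trans (isDimer-config) covering)))) (trans (zeroʳ _) (sym (zeroʳ _)))
      where open FromEdgeSet m χ
    ... | true = *-cong (trans (edgeWeight-flatten m (λ w → w) χ) (prodT-cong m χ single))
                        (reflexive (P.cong ind (P.trans isDimer-config covering)))
      where
      open FromEdgeSet m χ
      single : ∀ w → labelWeight (at χ w) ≈ singleWeight (at χ w)
      single w rewrite fewEdges Q covering w = ≈-refl

  Φ-closedForm : ∀ m → Φ R m a b c ≈ closedForm (parityOf m) (pow R X ((3 ^ m ∸ remainder (parityOf m)) / 4))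
  Φ-closedForm m = trans (Φ-as-Z m) (trans (Z-closedForm m)
    (reflexive (P.cong (λ e → closedForm (parityOf m) (pow R X e)) (P.sym (exponentOf-formula m)))))

ℕ-semiring : CommutativeSemiring Level.zero Level.zero
ℕ-semiring = ℕP.+-*-commutativeSemiring

-- With unit weights in ℕ every covering contributes 1.
length-as-Φ : ∀ m → length (dimerCoverings m) ≡ Φ ℕ-semiring m 1 1 1
length-as-Φ m = tally (dimerCoverings m)
  where
  unit : ∀ (D : List (TriEdge m)) → foldr N._*_ 1 (map (λ e → weight ℕ-semiring 1 1 1 (proj₂ e)) D) ≡ 1
  unit [] = refl
  unit ((w , zero) ∷ D) = P.trans (ℕP.*-identityˡ _) (unit D)
  unit ((w , suc zero) ∷ D) = P.trans (ℕP.*-identityˡ _) (unit D)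
  unit ((w , suc (suc zero)) ∷ D) = P.trans (ℕP.*-identityˡ _) (unit D)
  tally : ∀ Ds → length Ds ≡ foldr N._+_ 0 (map (λ D → foldr N._*_ 1 (map (λ e → weight ℕ-semiring 1 1 1 (proj₂ e)) D)) Ds)
  tally [] = refl
  tally (D ∷ Ds) = P.cong₂ N._+_ (P.sym (unit D)) (tally Ds)

pow-ℕ : ∀ x n → pow ℕ-semiring x n ≡ x ^ n
pow-ℕ x zero = refl
pow-ℕ x (suc n) = P.cong (x N.*_) (pow-ℕ x n)

halve : ∀ h {n} → n ≡ h N.* 2 → n / 2 ≡ h
halve h refl = m*n/n≡m h 2

closedForm-count : ∀ parity E → ClosedForm.closedForm ℕ-semiring 1 1 1 parity (pow ℕ-semiring 4 E)
                                ≡ 2 ^ ((E N.* 4 N.+ remainder parity N.+ 3) / 2)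
closedForm-count true E = begin
  pow ℕ-semiring 4 E N.* 4          ≡⟨ P.cong (N._* 4) (P.trans (pow-ℕ 4 E) (ℕP.^-*-assoc 2 2 E)) ⟩
  2 ^ (2 N.* E) N.* 2 ^ 2           ≡⟨ P.sym (ℕP.^-distribˡ-+-* 2 (2 N.* E) 2) ⟩
  2 ^ (2 N.* E N.+ 2)               ≡⟨ P.cong (2 ^_) (P.sym (halve (2 N.* E N.+ 2) (arith E))) ⟩
  2 ^ ((E N.* 4 N.+ 1 N.+ 3) / 2)   ∎
  where
  open P.≡-Reasoning
  open +-*-Solver
  arith : ∀ E → E N.* 4 N.+ 1 N.+ 3 ≡ (2 N.* E N.+ 2) N.* 2
  arith = solve 1 (λ E → E :* con 4 :+ con 1 :+ con 3 := (con 2 :* E :+ con 2) :* con 2) refl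
closedForm-count false E = begin
  2 N.* pow ℕ-semiring 4 E N.* 4    ≡⟨ P.cong (λ p → 2 N.* p N.* 4) (P.trans (pow-ℕ 4 E) (ℕP.^-*-assoc 2 2 E)) ⟩
  2 N.* 2 ^ (2 N.* E) N.* 4         ≡⟨ reorder (2 ^ (2 N.* E)) ⟩
  2 ^ (2 N.* E) N.* 2 ^ 3           ≡⟨ P.sym (ℕP.^-distribˡ-+-* 2 (2 N.* E) 3) ⟩
  2 ^ (2 N.* E N.+ 3)               ≡⟨ P.cong (2 ^_) (P.sym (halve (2 N.* E N.+ 3) (arith E))) ⟩
  2 ^ ((E N.* 4 N.+ 3 N.+ 3) / 2)   ∎
  where
  open P.≡-Reasoning
  open +-*-Solver
  reorder : ∀ p → 2 N.* p N.* 4 ≡ p N.* 8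
  reorder = solve 1 (λ p → con 2 :* p :* con 4 := p :* con 8) refl
  arith : ∀ E → E N.* 4 N.+ 3 N.+ 3 ≡ (2 N.* E N.+ 3) N.* 2
  arith = solve 1 (λ E → E :* con 4 :+ con 3 :+ con 3 := (con 2 :* E :+ con 3) :* con 2) refl

dimerCoverings-count : ∀ m → length (dimerCoverings m) ≡ 2 ^ ((3 ^ m N.+ 3) / 2)
dimerCoverings-count m = begin
  length (dimerCoverings m)
    ≡⟨ length-as-Φ m ⟩
  Φ ℕ-semiring m 1 1 1
    ≡⟨ DimerSum.Φ-closedForm ℕ-semiring 1 1 1 m ⟩
  closedForm (parityOf m) (pow ℕ-semiring 4 ((3 ^ m ∸ remainder (parityOf m)) / 4))
    ≡⟨ P.cong (λ e → closedForm (parityOf m) (pow ℕ-semiring 4 e)) (exponentOf-formula m) ⟩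
  closedForm (parityOf m) (pow ℕ-semiring 4 (exponentOf m))
    ≡⟨ closedForm-count (parityOf m) (exponentOf m) ⟩
  2 ^ ((exponentOf m N.* 4 N.+ remainder (parityOf m) N.+ 3) / 2)
    ≡⟨ P.cong (λ n → 2 ^ ((n N.+ 3) / 2)) (exponentOf-spec m) ⟩
  2 ^ ((3 ^ m N.+ 3) / 2) ∎
  where
  open P.≡-Reasoning
  open ClosedForm ℕ-semiring 1 1 1 using (closedForm)

parity-even : ∀ m → suc m % 2 ≡ 0 → parityOf m ≡ false
parity-even m h with parityOf m | isOdd-% (suc m)
... | false | _ = refl
... | true | e with () ← P.trans (P.sym e) h

parity-odd : ∀ m → suc m % 2 ≡ 1 → parityOf m ≡ true
parity-odd m h with parityOf m | isOdd-% (suc m)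
... | true | _ = refl
... | false | e with () ← P.trans (P.sym e) h

theorem4p1 : ∀ {c ℓ} (R : CommutativeSemiring c ℓ) (m : ℕ) →
    let open CommutativeSemiring R in
    ∀ (a b c : Carrier) →
      ((suc m % 2 ≡ 0) →
        Φ R m a b c ≈ ((1# + 1#) * pow R ((1# + 1#) * (1# + 1#) * a * b * c) ((3 ^ m ∸ 3) / 4))
                        * (a * b * c + a * b + a * c + b * c))
      × ((suc m % 2 ≡ 1) →
        Φ R m a b c ≈ pow R ((1# + 1#) * (1# + 1#) * a * b * c) ((3 ^ m ∸ 1) / 4)
                        * (1# + a + b + c))
      × (length (dimerCoverings m) ≡ 2 ^ ((3 ^ m N.+ 3) / 2))
theorem4p1 R m a b c = atParity false ∘ parity-even m , atParity true ∘ parity-odd m , dimerCoverings-count m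
  where
  open CommutativeSemiring R using (_≈_)
  open ClosedForm R a b c using (X; closedForm)
  atParity : ∀ p → parityOf m ≡ p → Φ R m a b c ≈ closedForm p (pow R X ((3 ^ m ∸ remainder p) / 4))
  atParity p refl = DimerSum.Φ-closedForm R a b c m
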